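{- For all positive integers $N$ and $k$, as formal power series in $q$, $$\sum_{n=1}^{\infty}\mu_{2k,N}(n)q^n=\frac{1}{(q)_N}\sum_{N\ge n_k\ge\cdots\ge n_1\ge1}\frac{q^{n_1+n_2+\cdots+n_k}}{(1-q^{n_1})^2(1-q^{n_2})^2\cdots(1-q^{n_k})^2},$$ where $\mu_{2k,N}(n):=\sum_{m=-n}^{n}\binom{m+k-1}{2k}M_{S_2}(m,n)$.
   Context: $(a)_n=(a;q)_n=\prod_{i=0}^{n-1}(1-aq^i)$, $(a)_0=1$; $\binom{x}{k}=\frac{x(x-1)\cdots(x-k+1)}{k!}$ for any integer $x$. For a partition $\pi$, $|\pi|$ is the sum of its parts, $\#(\pi)$ its number of parts, and $l(\pi)$ its largest part ($0$ if empty). Let $S_2$ be the set of triples $\vec\pi=(\pi_1,\pi_2,\pi_3)$ where $\pi_1$ is a partition into distinct parts and $\pi_2,\pi_3$ are partitions (all possibly empty), with $l(\pi_1),l(\pi_2),l(\pi_3)\le N$. Set $|\vec\pi|=|\pi_1|+|\pi_2|+|\pi_3|$, weight $w_c(\vec\pi)=(-1)^{\#(\pi_1)}$ and $\mathrm{crank}(\vec\pi)=\#(\pi_2)-\#(\pi_3)$. Define $M_{S_2}(m,n)=\sum_{\vec\pi\in S_2,\ |\vec\pi|=n,\ \mathrm{crank}(\vec\pi)=m} w_c(\vec\pi)$. -}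

module Defs where

open import Data.Bool using (Bool; true; false; _∧_; if_then_else_)
open import Data.Nat as ℕ using (ℕ; zero; suc; _!)
open import Data.Nat.Divisibility using (_∣?_)
open import Data.Nat.Properties using (_!≢0)
open import Data.Integer as ℤ using (ℤ; +_; -_; _+_; _-_; _*_; 0ℤ; 1ℤ)
open import Data.Integer.DivMod using (_/ℕ_)
open import Data.List using (List; []; _∷_; map; concatMap; upTo; foldr; length)
open import Data.Product using (_×_; _,_)
open import Relation.Nullary.Decidable using (⌊_⌋)

-- Generalised binomial coefficient  binom x k = x(x-1)...(x-k+1)/k!
-- for any integer x (the division is exact).

fallingℤ : ℤ → ℕ → ℤ
fallingℤ x zero    = 1ℤ
fallingℤ x (suc j) = fallingℤ x j * (x - + j)

binom : ℤ → ℕ → ℤ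
binom x k = _/ℕ_ (fallingℤ x k) (k !) {{k !≢0}}

sumℤ : List ℤ → ℤ
sumℤ = foldr _+_ 0ℤ

sumℕ : List ℕ → ℕ
sumℕ = foldr ℕ._+_ 0

-- Enumeration of partitions.  A partition is represented as the list of
-- its parts; parts lie in [1..N] (i.e. largest part ≤ N).

oneTo : ℕ → List ℕ
oneTo N = map suc (upTo N)

listsOfLength : ℕ → ℕ → List (List ℕ)
listsOfLength N zero    = [] ∷ []
listsOfLength N (suc L) = concatMap (λ x → map (x ∷_) (listsOfLength N L)) (oneTo N)

listsUpTo : ℕ → ℕ → List (List ℕ)
listsUpTo N n = concatMap (listsOfLength N) (upTo (suc n))

nonIncreasing : List ℕ → Bool
nonIncreasing []           = true
nonIncreasing (x ∷ [])     = true
nonIncreasing (x ∷ y ∷ xs) = ⌊ y ℕ.≤? x ⌋ ∧ nonIncreasing (y ∷ xs)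

decreasing : List ℕ → Bool
decreasing []           = true
decreasing (x ∷ [])     = true
decreasing (x ∷ y ∷ xs) = ⌊ y ℕ.<? x ⌋ ∧ decreasing (y ∷ xs)

nonDecreasing : List ℕ → Bool
nonDecreasing []           = true
nonDecreasing (x ∷ [])     = true
nonDecreasing (x ∷ y ∷ xs) = ⌊ x ℕ.≤? y ⌋ ∧ nonDecreasing (y ∷ xs)

-- Candidate triples (π₁, π₂, π₃): each a list of at most n parts in [1..N].
-- Every element of S₂ with |π| = n has this form (all parts are ≥ 1).
Triple : Set
Triple = List ℕ × List ℕ × List ℕ

candidates : ℕ → ℕ → List Triple
candidates N n =
  concatMap (λ p₁ → concatMap (λ p₂ → map (λ p₃ → p₁ , p₂ , p₃)
    (listsUpTo N n)) (listsUpTo N n)) (listsUpTo N n)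

inS₂of : ℕ → Triple → Bool
inS₂of n (p₁ , p₂ , p₃) =
  decreasing p₁ ∧ nonIncreasing p₂ ∧ nonIncreasing p₃
  ∧ ⌊ sumℕ p₁ ℕ.+ sumℕ p₂ ℕ.+ sumℕ p₃ ℕ.≟ n ⌋

signPow : ℕ → ℤ
signPow zero    = 1ℤ
signPow (suc j) = - signPow j

weight : Triple → ℤ
weight (p₁ , p₂ , p₃) = signPow (length p₁)

crank : Triple → ℤ
crank (p₁ , p₂ , p₃) = + length p₂ - + length p₃

-- M_{S₂}(m, n)   (N is the bound on the largest parts)
M-S₂ : ℕ → ℤ → ℕ → ℤ
M-S₂ N m n = sumℤ (map (λ t → if inS₂of n t ∧ ⌊ crank t ℤ.≟ m ⌋ then weight t else 0ℤ)
                       (candidates N n))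

μ : ℕ → ℕ → ℕ → ℤ
μ k N n = sumℤ (map (λ m → binom (m + + k - 1ℤ) (2 ℕ.* k) * M-S₂ N m n)
                    (map (λ i → + i - + n) (upTo (suc (2 ℕ.* n)))))

Series : Set
Series = ℕ → ℤ

zeroS : Series
zeroS _ = 0ℤ

oneS : Series
oneS zero    = 1ℤ
oneS (suc _) = 0ℤ

_⊕_ : Series → Series → Series
(f ⊕ g) n = f n + g n

_⊛_ : Series → Series → Series
(f ⊛ g) n = sumℤ (map (λ i → f i * g (n ℕ.∸ i)) (upTo (suc n)))

sumS : List Series → Series
sumS = foldr _⊕_ zeroS

prodS : List Series → Series
prodS = foldr _⊛_ oneS

monomial : ℕ → Series
monomial a n = if ⌊ n ℕ.≟ a ⌋ then 1ℤ else 0ℤ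

-- 1/(1 - q^a) = Σ_{j ≥ 0} q^{a j}   (used only for a ≥ 1)
invOneMinus : ℕ → Series
invOneMinus a n = if ⌊ a ∣? n ⌋ then 1ℤ else 0ℤ

invPoch : ℕ → Series
invPoch N = prodS (map invOneMinus (oneTo N))

chainTerm : ℕ → Series
chainTerm a = monomial a ⊛ (invOneMinus a ⊛ invOneMinus a)

-- Σ_{N ≥ n_k ≥ ... ≥ n_1 ≥ 1} Π_i q^{n_i}/(1-q^{n_i})^2 ;
-- a chain is the list (n_1, ..., n_k), nondecreasing with entries in [1..N].
chainSum : ℕ → ℕ → Series
chainSum k N = sumS (map (λ c → if nonDecreasing c then prodS (map chainTerm c) else zeroS)
                         (listsOfLength N k))

rhsSeries : ℕ → ℕ → Series
rhsSeries k N = invPoch N ⊛ chainSum k N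

lhsSeries : ℕ → ℕ → Series
lhsSeries k N zero    = 0ℤ
lhsSeries k N (suc n) = μ k N (suc n)

-- Let X_{a,b}(f) = Σ f(#π₂ − #π₃) q^{|π₂|+|π₃|} over pairs of partitions whose parts are at most a
-- and at most b, and let (q)_b = Σ (−1)^{#π₁} q^{|π₁|} over partitions π₁ into distinct parts at most b.
-- The left-hand side is then (q)_N X_{N,N}(g_k) with g_k(m) = binom(m + k − 1, 2k).  Splitting off
-- the parts equal to N in π₂ and in π₃ gives
--   (1 − q^N)² X_{N,N}(f) = X_{N−1,N−1}(f) + q^N X_{N,N}(Δ²f),   Δ²f(m) = f(m+1) + f(m−1) − 2f(m),
-- and Pascal's rule gives Δ²g_{k+1} = g_k.  Hence R_b(k) = (q)_b² X_{b,b}(g_k) satisfies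
--   R_b(k+1) = R_{b−1}(k+1) + q^b/(1 − q^b)² R_b(k),
-- the recursion of the chain sums on the right-hand side (peel off the largest element n_k = b), with the
-- same initial values R_0(k) = g_k(0) = [k = 0].  Dividing R_N(k) by (q)_N gives the theorem.
module Submission where

open import Defs
open import Algebra.Bundles using (CommutativeRing; RawRing)
import Algebra.Solver.Ring.AlmostCommutativeRing as ACR
open import Data.Bool using (Bool; true; false; _∧_; if_then_else_)
open import Data.Empty using (⊥; ⊥-elim)
open import Data.Integer as ℤ using (ℤ; +_; -_; -[1+_]; _+_; _-_; _*_; 0ℤ; 1ℤ)
open import Data.Integer.DivMod using (_/ℕ_; _%ℕ_; a≡a%ℕn+[a/ℕn]*n; n%ℕd<d)
import Data.Integer.Properties as ℤP
open import Data.Integer.Tactic.RingSolver using (solve-∀)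
open import Data.List using (List; []; _∷_; map; concatMap; upTo; length; _++_; [_])
import Data.List.Properties as LP
open import Data.Maybe using (Maybe; just; nothing)
open import Data.Nat as ℕ using (ℕ; zero; suc; _≤_; _<_; z≤n; s≤s; _∸_; _!; pred)
open import Data.Nat.Divisibility as Div using (_∣_; _∣?_)
import Data.Nat.Properties as ℕP
open import Data.Product using (Σ; _×_; _,_)
open import Function using (_∘_)
open import Relation.Binary.PropositionalEquality hiding ([_])
open import Relation.Nullary using (Dec; yes; no; ¬_)
open import Relation.Nullary.Decidable using (⌊_⌋; _×-dec_)
import Relation.Binary.Reasoning.Setoid

ind : Bool → ℤ → ℤ
ind b x = if b then x else 0ℤ

ind-iff : {P Q : Set} (d : Dec P) (e : Dec Q) → (P → Q) → (Q → P) → (x : ℤ) → ind ⌊ d ⌋ x ≡ ind ⌊ e ⌋ x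
ind-iff (yes p) (yes q) pq qp x = refl
ind-iff (yes p) (no ¬q) pq qp x = ⊥-elim (¬q (pq p))
ind-iff (no ¬p) (yes q) pq qp x = ⊥-elim (¬p (qp q))
ind-iff (no ¬p) (no ¬q) pq qp x = refl

ind-*ʳ : ∀ b x y → ind b x * y ≡ ind b (x * y)
ind-*ʳ true x y = refl
ind-*ʳ false x y = ℤP.*-zeroˡ y

ind-*ˡ : ∀ b x y → y * ind b x ≡ ind b (y * x)
ind-*ˡ true x y = refl
ind-*ˡ false x y = ℤP.*-zeroʳ y

ind-cong : ∀ b {x y} → x ≡ y → ind b x ≡ ind b y
ind-cong b refl = refl

ind-∧ : ∀ a b x → ind (a ∧ b) x ≡ ind a (ind b x)
ind-∧ true b x = refl
ind-∧ false b x = refl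

ind-yes : {P : Set} (d : Dec P) → P → ∀ x → ind ⌊ d ⌋ x ≡ x
ind-yes (yes p) _ x = refl
ind-yes (no ¬p) p x = ⊥-elim (¬p p)

ind-no : {P : Set} (d : Dec P) → ¬ P → ∀ x → ind ⌊ d ⌋ x ≡ 0ℤ
ind-no (yes p) ¬p x = ⊥-elim (¬p p)
ind-no (no _) _ x = refl

ind-case : ∀ {P : Set} (d : Dec P) {x y : ℤ} → (P → x ≡ y) → ind ⌊ d ⌋ x ≡ ind ⌊ d ⌋ y
ind-case (yes p) e = e p
ind-case (no _) e = refl

ind-zero : ∀ b → ind b 0ℤ ≡ 0ℤ
ind-zero true = refl
ind-zero false = refl

ind-comm : ∀ a b x → ind a (ind b x) ≡ ind b (ind a x)
ind-comm true b x = refl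
ind-comm false true x = refl
ind-comm false false x = refl

ind-dec-∧ : ∀ {P Q : Set} (d : Dec P) (e : Dec Q) x → ind (⌊ d ⌋ ∧ ⌊ e ⌋) x ≡ ind ⌊ d ×-dec e ⌋ x
ind-dec-∧ (yes p) (yes q) x = refl
ind-dec-∧ (yes p) (no q) x = refl
ind-dec-∧ (no p) e x = refl

ind²-iff : ∀ {P Q R T : Set} (d : Dec P) (e : Dec Q) (d' : Dec R) (e' : Dec T) → (P × Q → R × T) → (R × T → P × Q) → ∀ x →
  ind ⌊ d ⌋ (ind ⌊ e ⌋ x) ≡ ind ⌊ d' ⌋ (ind ⌊ e' ⌋ x)
ind²-iff d e d' e' f g x = trans (sym (ind-∧ ⌊ d ⌋ ⌊ e ⌋ x)) (trans (ind-dec-∧ d e x) (trans (ind-iff (d ×-dec e) (d' ×-dec e') f g x)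
   (trans (sym (ind-dec-∧ d' e' x)) (ind-∧ ⌊ d' ⌋ ⌊ e' ⌋ x))))

range : ℕ → List ℕ
range n = upTo (suc n)

-- Opaque, so that type checking (notably `with`-abstraction) never unfolds a sum.
opaque
  ∑ : {A : Set} → List A → (A → ℤ) → ℤ
  ∑ xs f = sumℤ (map f xs)
  ∑-def : {A : Set} (xs : List A) (f : A → ℤ) → ∑ xs f ≡ sumℤ (map f xs)
  ∑-def xs f = refl
  ∑-∷ : {A : Set} (x : A) (xs : List A) (f : A → ℤ) → ∑ (x ∷ xs) f ≡ f x + ∑ xs f
  ∑-∷ x xs f = refl
  ∑-[] : {A : Set} (f : A → ℤ) → ∑ [] f ≡ 0ℤ
  ∑-[] f = refl
  ∑-++ : {A : Set} (xs ys : List A) (f : A → ℤ) → ∑ (xs ++ ys) f ≡ ∑ xs f + ∑ ys f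
  ∑-++ [] ys f = sym (ℤP.+-identityˡ _)
  ∑-++ (x ∷ xs) ys f = trans (cong (_+_ (f x)) (∑-++ xs ys f)) (sym (ℤP.+-assoc (f x) _ _))
  ∑-cong : {A : Set} (xs : List A) {f g : A → ℤ} → (∀ x → f x ≡ g x) → ∑ xs f ≡ ∑ xs g
  ∑-cong [] eq = refl
  ∑-cong (x ∷ xs) eq = cong₂ _+_ (eq x) (∑-cong xs eq)
  ∑-zero : {A : Set} (xs : List A) → ∑ xs (λ _ → 0ℤ) ≡ 0ℤ
  ∑-zero [] = refl
  ∑-zero (x ∷ xs) = trans (ℤP.+-identityˡ _) (∑-zero xs)
  ∑-vanish : {A : Set} (xs : List A) {f : A → ℤ} → (∀ x → f x ≡ 0ℤ) → ∑ xs f ≡ 0ℤ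
  ∑-vanish xs eq = trans (∑-cong xs eq) (∑-zero xs)
  ∑-+ : {A : Set} (xs : List A) (f g : A → ℤ) → ∑ xs (λ x → f x + g x) ≡ ∑ xs f + ∑ xs g
  ∑-+ [] f g = refl
  ∑-+ (x ∷ xs) f g = trans (cong (_+_ (f x + g x)) (∑-+ xs f g)) (lem (f x) (g x) (∑ xs f) (∑ xs g))
    where
    lem : ∀ a b c d → a + b + (c + d) ≡ a + c + (b + d)
    lem = solve-∀
  ∑-neg : {A : Set} (xs : List A) (f : A → ℤ) → ∑ xs (λ x → - f x) ≡ - ∑ xs f
  ∑-neg [] f = refl
  ∑-neg (x ∷ xs) f = trans (cong (_+_ (- f x)) (∑-neg xs f)) (sym (ℤP.neg-distrib-+ (f x) (∑ xs f)))
  ∑-*ˡ : {A : Set} (xs : List A) (c : ℤ) (f : A → ℤ) → ∑ xs (λ x → c * f x) ≡ c * ∑ xs f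
  ∑-*ˡ [] c f = sym (ℤP.*-zeroʳ c)
  ∑-*ˡ (x ∷ xs) c f = trans (cong (_+_ (c * f x)) (∑-*ˡ xs c f)) (sym (ℤP.*-distribˡ-+ c (f x) _))
  ∑-*ʳ : {A : Set} (xs : List A) (c : ℤ) (f : A → ℤ) → ∑ xs (λ x → f x * c) ≡ ∑ xs f * c
  ∑-*ʳ xs c f = trans (∑-cong xs (λ x → ℤP.*-comm (f x) c)) (trans (∑-*ˡ xs c f) (ℤP.*-comm c _))
  ∑-swap : {A B : Set} (xs : List A) (ys : List B) (h : A → B → ℤ) →
           ∑ xs (λ x → ∑ ys (λ y → h x y)) ≡ ∑ ys (λ y → ∑ xs (λ x → h x y))
  ∑-swap [] ys h = sym (∑-zero ys)
  ∑-swap (x ∷ xs) ys h = trans (cong (_+_ (∑ ys (h x))) (∑-swap xs ys h)) (sym (∑-+ ys (h x) _))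
  ∑-map : {A B : Set} (g : A → B) (xs : List A) (f : B → ℤ) → ∑ (map g xs) f ≡ ∑ xs (f ∘ g)
  ∑-map g [] f = refl
  ∑-map g (x ∷ xs) f = cong (_+_ (f (g x))) (∑-map g xs f)
  ∑-concatMap : {A B : Set} (g : A → List B) (xs : List A) (f : B → ℤ) →
                ∑ (concatMap g xs) f ≡ ∑ xs (λ x → ∑ (g x) f)
  ∑-concatMap g [] f = refl
  ∑-concatMap g (x ∷ xs) f = trans (∑-++ (g x) (concatMap g xs) f) (cong (_+_ (∑ (g x) f)) (∑-concatMap g xs f))
  upTo-suc : ∀ n → upTo (suc n) ≡ 0 ∷ map suc (upTo n)
  upTo-suc n = cong (0 ∷_) (sym (LP.map-upTo suc n))
  ∑-upTo-suc : ∀ n (f : ℕ → ℤ) → ∑ (upTo (suc n)) f ≡ f 0 + ∑ (upTo n) (f ∘ suc)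
  ∑-upTo-suc n f = trans (cong (λ l → ∑ l f) (upTo-suc n)) (cong (_+_ (f 0)) (∑-map suc (upTo n) f))
  ∑-upTo-∷ʳ : ∀ n (f : ℕ → ℤ) → ∑ (upTo (suc n)) f ≡ ∑ (upTo n) f + f n
  ∑-upTo-∷ʳ n f = trans (cong (λ l → ∑ l f) (sym (LP.upTo-∷ʳ n)))
    (trans (∑-++ (upTo n) [ n ] f) (cong (_+_ (∑ (upTo n) f)) (ℤP.+-identityʳ (f n))))
  ∑-upTo-cong : ∀ n {f g : ℕ → ℤ} → (∀ i → i < n → f i ≡ g i) → ∑ (upTo n) f ≡ ∑ (upTo n) g
  ∑-upTo-cong zero eq = refl
  ∑-upTo-cong (suc n) {f} {g} eq = trans (∑-upTo-∷ʳ n f)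
    (trans (cong₂ _+_ (∑-upTo-cong n (λ i i<n → eq i (ℕP.m<n⇒m<1+n i<n))) (eq n ℕP.≤-refl))
           (sym (∑-upTo-∷ʳ n g)))
  ∑-upTo-pad : ∀ M K {h : ℕ → ℤ} → (∀ i → M ≤ i → h i ≡ 0ℤ) → ∑ (upTo (K ℕ.+ M)) h ≡ ∑ (upTo M) h
  ∑-upTo-pad M zero eq = refl
  ∑-upTo-pad M (suc K) {h} eq = trans (∑-upTo-∷ʳ (K ℕ.+ M) h)
    (trans (cong₂ _+_ (∑-upTo-pad M K eq) (eq (K ℕ.+ M) (ℕP.m≤n+m M K))) (ℤP.+-identityʳ _))
  ∑-upTo-extend : ∀ M M' {h : ℕ → ℤ} → M ≤ M' → (∀ i → M ≤ i → h i ≡ 0ℤ) → ∑ (upTo M') h ≡ ∑ (upTo M) h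
  ∑-upTo-extend M M' {h} le eq = trans (cong (λ k → ∑ (upTo k) h) (sym (ℕP.m∸n+n≡m le))) (∑-upTo-pad M (M' ∸ M) eq)
  ∑-upTo-select : ∀ n c (h : ℕ → ℤ) → ∑ (upTo n) (λ i → ind ⌊ i ℕ.≟ c ⌋ (h i)) ≡ ind ⌊ c ℕ.<? n ⌋ (h c)
  ∑-upTo-select zero c h = refl
  ∑-upTo-select (suc n) c h = trans (∑-upTo-∷ʳ n _) (trans (cong (λ z → z + ind ⌊ n ℕ.≟ c ⌋ (h n)) (∑-upTo-select n c h)) (step (c ℕ.<? n) (n ℕ.≟ c)
      (c ℕ.<? suc n)))
    where
    step : (d : Dec (c < n)) (e : Dec (n ≡ c)) (f : Dec (c < suc n)) → ind ⌊ d ⌋ (h c) + ind ⌊ e ⌋ (h n) ≡ ind ⌊ f ⌋ (h c)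
    step (yes p) (yes refl) f = ⊥-elim (ℕP.<-irrefl refl p)
    step (yes p) (no ¬q) (yes _) = ℤP.+-identityʳ _
    step (yes p) (no ¬q) (no ¬r) = ⊥-elim (¬r (ℕP.m<n⇒m<1+n p))
    step (no ¬p) (yes refl) (yes _) = ℤP.+-identityˡ _
    step (no ¬p) (yes refl) (no ¬r) = ⊥-elim (¬r ℕP.≤-refl)
    step (no ¬p) (no ¬q) (yes r) = ⊥-elim (¬q (sym (ℕP.≤-antisym (ℕP.≤-pred r) (ℕP.≮⇒≥ ¬p))))
    step (no ¬p) (no ¬q) (no ¬r) = refl

∑-ind : ∀ {A : Set} (xs : List A) b (f : A → ℤ) → ∑ xs (λ x → ind b (f x)) ≡ ind b (∑ xs f)
∑-ind xs true f = refl
∑-ind xs false f = ∑-zero xs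

∑-upTo-select′ : ∀ n c (h : ℕ → ℤ) → ∑ (upTo n) (λ i → ind ⌊ c ℕ.≟ i ⌋ (h i)) ≡ ind ⌊ c ℕ.<? n ⌋ (h c)
∑-upTo-select′ n c h = trans (∑-cong (upTo n) (λ i → ind-iff (c ℕ.≟ i) (i ℕ.≟ c) sym sym (h i))) (∑-upTo-select n c h)

∑-upTo-select-< : ∀ n c (h : ℕ → ℤ) → c < n → ∑ (upTo n) (λ i → ind ⌊ i ℕ.≟ c ⌋ (h i)) ≡ h c
∑-upTo-select-< n c h lt = trans (∑-upTo-select n c h) (ind-yes (c ℕ.<? n) lt (h c))

∑-singleton : ∀ {A : Set} (x : A) f → ∑ [ x ] f ≡ f x
∑-singleton x f = trans (∑-def [ x ] f) (ℤP.+-identityʳ (f x))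

∑-oneTo : ∀ N (f : ℕ → ℤ) → ∑ (oneTo N) f ≡ ∑ (upTo N) (f ∘ suc)
∑-oneTo N f = ∑-map suc (upTo N) f

∑-upTo-head : ∀ s (h : ℕ → ℤ) → (∀ L → h (suc L) ≡ 0ℤ) → ∑ (range s) h ≡ h 0
∑-upTo-head s h e = trans (∑-upTo-suc s h) (trans (cong (_+_ (h 0)) (∑-vanish (upTo s) e)) (ℤP.+-identityʳ (h 0)))

∑³-+ : ∀ (xs ys zs : List ℕ) (A B : ℕ → ℕ → ℕ → ℤ) →
  ∑ xs (λ i → ∑ ys (λ j → ∑ zs (λ k → A i j k + B i j k))) ≡
  ∑ xs (λ i → ∑ ys (λ j → ∑ zs (λ k → A i j k))) + ∑ xs (λ i → ∑ ys (λ j → ∑ zs (λ k → B i j k)))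
∑³-+ xs ys zs A B = trans (∑-cong xs (λ i → trans (∑-cong ys (λ j → ∑-+ zs (A i j) (B i j))) (∑-+ ys _ _))) (∑-+ xs _ _)

∑-upTo-shift : ∀ c s (G : ℕ → ℤ) → ∑ (range s) (λ i → ind ⌊ c ℕ.≤? i ⌋ (G (i ∸ c))) ≡ ind ⌊ c ℕ.≤? s ⌋ (∑ (range (s ∸ c)) G)
∑-upTo-shift zero s G = refl
∑-upTo-shift (suc c) s G = trans (∑-upTo-suc s _) (trans (ℤP.+-identityˡ _) (trans
   (∑-cong (upTo s) (λ i → ind-iff (suc c ℕ.≤? suc i) (c ℕ.≤? i) ℕP.≤-pred s≤s (G (i ∸ c)))) (rest s)))
  where
  rest : ∀ s → ∑ (upTo s) (λ i → ind ⌊ c ℕ.≤? i ⌋ (G (i ∸ c))) ≡ ind ⌊ suc c ℕ.≤? s ⌋ (∑ (range (s ∸ suc c)) G)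
  rest zero = ∑-def [] _
  rest (suc s) = trans (∑-upTo-shift c s G) (ind-iff (c ℕ.≤? s) (suc c ℕ.≤? suc s) s≤s ℕP.≤-pred _)

∑-upTo-restrict : ∀ c s (H : ℕ → ℤ) → ∑ (range s) (λ i → ind ⌊ c ℕ.≤? s ∸ i ⌋ (H i)) ≡ ind ⌊ c ℕ.≤? s ⌋ (∑ (range (s ∸ c)) H)
∑-upTo-restrict c s H with c ℕ.≤? s
... | no ¬le = ∑-vanish (range s) (λ i → ind-no (c ℕ.≤? s ∸ i) (λ le → ¬le (ℕP.≤-trans le (ℕP.m∸n≤m s i))) (H i))
... | yes le = trans (∑-upTo-cong (suc s) (λ i i<ss → ind-iff (c ℕ.≤? s ∸ i) (i ℕ.≤? s ∸ c) (fw i (ℕP.≤-pred i<ss)) (bw i (ℕP.≤-pred i<ss)) (H i)))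
   (trans (∑-upTo-extend (suc (s ∸ c)) (suc s) (s≤s (ℕP.m∸n≤m s c)) (λ i ge → ind-no (i ℕ.≤? s ∸ c) (λ le' → ℕP.<-irrefl refl (ℕP.<-≤-trans ge le'))
       (H i)))
          (∑-upTo-cong (suc (s ∸ c)) (λ i lt → ind-yes (i ℕ.≤? s ∸ c) (ℕP.≤-pred lt) (H i))))
  where
  fw : ∀ i → i ≤ s → c ≤ s ∸ i → i ≤ s ∸ c
  fw i is le' = ℕP.m+n≤o⇒m≤o∸n i (ℕP.≤-trans (ℕP.≤-reflexive (ℕP.+-comm i c)) (ℕP.m≤o∸n⇒m+n≤o c is le'))
  bw : ∀ i → i ≤ s → i ≤ s ∸ c → c ≤ s ∸ i
  bw i is le' = ℕP.m+n≤o⇒m≤o∸n c (ℕP.≤-trans (ℕP.≤-reflexive (ℕP.+-comm c i)) (ℕP.m≤o∸n⇒m+n≤o i le le'))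

infix 4 _≈_
_≈_ : Series → Series → Set
f ≈ g = ∀ n → f n ≡ g n

⊛-∑ : ∀ f g n → (f ⊛ g) n ≡ ∑ (range n) (λ i → f i * g (n ∸ i))
⊛-∑ f g n = sym (∑-def (range n) (λ i → f i * g (n ∸ i)))

⊛₂ : Series → Series → Series
⊛₂ f g n = ∑ (range n) λ i → ∑ (range n) λ j → ind ⌊ i ℕ.+ j ℕ.≟ n ⌋ (f i * g j)

⊛≈⊛₂ : ∀ f g → (f ⊛ g) ≈ ⊛₂ f g
⊛≈⊛₂ f g n = trans (⊛-∑ f g n) (∑-upTo-cong (suc n) λ i i<sn → sym (inner i (ℕP.≤-pred i<sn)))
  where
  inner : ∀ i → i ≤ n → ∑ (range n) (λ j → ind ⌊ i ℕ.+ j ℕ.≟ n ⌋ (f i * g j)) ≡ f i * g (n ∸ i)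
  inner i le = trans (∑-cong (range n) (λ j → ind-iff (i ℕ.+ j ℕ.≟ n) (j ℕ.≟ n ∸ i)
                       (λ e → trans (sym (ℕP.m+n∸m≡n i j)) (cong (_∸ i) e))
                       (λ e → trans (cong (i ℕ.+_) e) (ℕP.m+[n∸m]≡n le)) (f i * g j)))
                (∑-upTo-select-< (suc n) (n ∸ i) (λ j → f i * g j) (s≤s (ℕP.m∸n≤m n i)))

⊛₂-comm : ∀ f g → ⊛₂ f g ≈ ⊛₂ g f
⊛₂-comm f g n = trans (∑-swap (range n) (range n) (λ i j → ind ⌊ i ℕ.+ j ℕ.≟ n ⌋ (f i * g j)))
  (∑-cong (range n) λ j → ∑-cong (range n) λ i →
     trans (ind-iff (i ℕ.+ j ℕ.≟ n) (j ℕ.+ i ℕ.≟ n) (λ e → trans (ℕP.+-comm j i) e) (λ e → trans (ℕP.+-comm i j) e) _)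
           (ind-cong ⌊ j ℕ.+ i ℕ.≟ n ⌋ (ℤP.*-comm (f i) (g j))))

⊛-comm : ∀ f g → (f ⊛ g) ≈ (g ⊛ f)
⊛-comm f g n = trans (⊛≈⊛₂ f g n) (trans (⊛₂-comm f g n) (sym (⊛≈⊛₂ g f n)))

⊛-cong : ∀ {f f' g g'} → f ≈ f' → g ≈ g' → (f ⊛ g) ≈ (f' ⊛ g')
⊛-cong {f} {f'} {g} {g'} ef eg n = trans (⊛-∑ f g n) (trans (∑-cong (range n) λ i → cong₂ _*_ (ef i) (eg (n ∸ i))) (sym (⊛-∑ f' g' n)))

⊛-congˡ : ∀ {f f'} g → f ≈ f' → (f ⊛ g) ≈ (f' ⊛ g)
⊛-congˡ g ef = ⊛-cong {g = g} {g} ef (λ _ → refl)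

⊛-congʳ : ∀ f {g g'} → g ≈ g' → (f ⊛ g) ≈ (f ⊛ g')
⊛-congʳ f eg = ⊛-cong {f} {f} (λ _ → refl) eg

⊕-cong : ∀ {f f' g g'} → f ≈ f' → g ≈ g' → (f ⊕ g) ≈ (f' ⊕ g')
⊕-cong ef eg n = cong₂ _+_ (ef n) (eg n)

≈-sym : ∀ {f g} → f ≈ g → g ≈ f
≈-sym e n = sym (e n)

≈-trans : ∀ {f g h} → f ≈ g → g ≈ h → f ≈ h
≈-trans e e' n = trans (e n) (e' n)

⊛-distribˡ : ∀ f g h → (f ⊛ (g ⊕ h)) ≈ ((f ⊛ g) ⊕ (f ⊛ h))
⊛-distribˡ f g h n = trans (⊛-∑ f (g ⊕ h) n) (trans (∑-cong (range n) (λ i → ℤP.*-distribˡ-+ (f i) (g (n ∸ i)) (h (n ∸ i))))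
   (trans (∑-+ (range n) (λ i → f i * g (n ∸ i)) (λ i → f i * h (n ∸ i))) (sym (cong₂ _+_ (⊛-∑ f g n) (⊛-∑ f h n)))))

⊛-distribʳ : ∀ f g h → ((g ⊕ h) ⊛ f) ≈ ((g ⊛ f) ⊕ (h ⊛ f))
⊛-distribʳ f g h = ≈-trans (⊛-comm (g ⊕ h) f) (≈-trans (⊛-distribˡ f g h) (⊕-cong (⊛-comm f g) (⊛-comm f h)))

⊛-oneʳ : ∀ f → (f ⊛ oneS) ≈ f
⊛-oneʳ f n = trans (⊛-∑ f oneS n) (trans (∑-upTo-cong (suc n) (λ i i<sn → lem i (ℕP.≤-pred i<sn)))
                   (∑-upTo-select-< (suc n) n f ℕP.≤-refl))
  where
  lem : ∀ i → i ≤ n → f i * oneS (n ∸ i) ≡ ind ⌊ i ℕ.≟ n ⌋ (f i)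
  lem i le with i ℕ.≟ n
  ... | yes refl rewrite ℕP.n∸n≡0 i = ℤP.*-identityʳ (f i)
  ... | no ne with n ∸ i in eq
  ... | zero = ⊥-elim (ne (ℕP.≤-antisym le (ℕP.m∸n≡0⇒m≤n eq)))
  ... | suc _ = ℤP.*-zeroʳ (f i)

⊛-oneˡ : ∀ f → (oneS ⊛ f) ≈ f
⊛-oneˡ f = ≈-trans (⊛-comm oneS f) (⊛-oneʳ f)

⊛-zeroʳ : ∀ f → (f ⊛ zeroS) ≈ zeroS
⊛-zeroʳ f n = trans (⊛-∑ f zeroS n) (∑-vanish (range n) (λ i → ℤP.*-zeroʳ (f i)))

⊛₂ᴮ : ℕ → Series → Series → Series
⊛₂ᴮ B f g n = ∑ (upTo B) λ i → ∑ (upTo B) λ j → ind ⌊ i ℕ.+ j ℕ.≟ n ⌋ (f i * g j)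

⊛₂-bound : ∀ f g a B → suc a ≤ B → ⊛₂ f g a ≡ ⊛₂ᴮ B f g a
⊛₂-bound f g a B le = sym (trans (∑-cong (upTo B) (λ i → ∑-upTo-extend (suc a) B le (λ j aj → ind-no (i ℕ.+ j ℕ.≟ a) (λ e → ℕP.<-irrefl refl
    (ℕP.<-≤-trans (ℕP.≤-trans aj (ℕP.m≤n+m j i)) (ℕP.≤-reflexive e))) _)))
   (∑-upTo-extend (suc a) B le (λ i ai → ∑-vanish (range a) (λ j → ind-no (i ℕ.+ j ℕ.≟ a) (λ e → ℕP.<-irrefl refl (ℕP.<-≤-trans (ℕP.≤-trans ai
       (ℕP.m≤m+n i j)) (ℕP.≤-reflexive e))) _))))

⊛₃ : Series → Series → Series → Series
⊛₃ f g h n = ∑ (range n) λ i → ∑ (range n) λ j → ∑ (range n) λ l → ind ⌊ i ℕ.+ j ℕ.+ l ℕ.≟ n ⌋ (f i * g j * h l)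

⊛⊛≡⊛₃ : ∀ f g h n → ((f ⊛ g) ⊛ h) n ≡ ⊛₃ f g h n
⊛⊛≡⊛₃ f g h n =
  begin
    ((f ⊛ g) ⊛ h) n
  ≡⟨ ⊛≈⊛₂ (f ⊛ g) h n ⟩
    ∑ (range n) (λ a → ∑ (range n) λ l → ind ⌊ a ℕ.+ l ℕ.≟ n ⌋ ((f ⊛ g) a * h l))
  ≡⟨ ∑-upTo-cong (suc n) (λ a a<sn → ∑-cong (range n) λ l → ind-cong ⌊ a ℕ.+ l ℕ.≟ n ⌋
        (cong (_* h l) (trans (⊛≈⊛₂ f g a) (⊛₂-bound f g a (suc n) a<sn)))) ⟩
    ∑ (range n) (λ a → ∑ (range n) λ l → ind ⌊ a ℕ.+ l ℕ.≟ n ⌋ (⊛₂ᴮ (suc n) f g a * h l))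
  ≡⟨ ∑-cong (range n) (λ a → ∑-cong (range n) λ l → trans (ind-cong ⌊ a ℕ.+ l ℕ.≟ n ⌋ (expand a l)) (trans (sym (∑-ind (range n) ⌊ a ℕ.+ l ℕ.≟ n ⌋
      (λ i → ∑ (range n) λ j → ind ⌊ i ℕ.+ j ℕ.≟ a ⌋ (f i * g j * h l)))) (∑-cong (range n) λ i → sym (∑-ind (range n) ⌊ a ℕ.+ l ℕ.≟ n ⌋
      (λ j → ind ⌊ i ℕ.+ j ℕ.≟ a ⌋ (f i * g j * h l)))))) ⟩
    ∑ (range n) (λ a → ∑ (range n) λ l → ∑ (range n) λ i → ∑ (range n) λ j → ind ⌊ a ℕ.+ l ℕ.≟ n ⌋ (ind ⌊ i ℕ.+ j ℕ.≟ a ⌋ (f i * g j * h l)))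
  ≡⟨ ∑-cong (range n) (λ a → ∑-swap (range n) (range n) _) ⟩
    ∑ (range n) (λ a → ∑ (range n) λ i → ∑ (range n) λ l → ∑ (range n) λ j → ind ⌊ a ℕ.+ l ℕ.≟ n ⌋ (ind ⌊ i ℕ.+ j ℕ.≟ a ⌋ (f i * g j * h l)))
  ≡⟨ ∑-cong (range n) (λ a → ∑-cong (range n) λ i → ∑-swap (range n) (range n) _) ⟩
    ∑ (range n) (λ a → ∑ (range n) λ i → ∑ (range n) λ j → ∑ (range n) λ l → ind ⌊ a ℕ.+ l ℕ.≟ n ⌋ (ind ⌊ i ℕ.+ j ℕ.≟ a ⌋ (f i * g j * h l)))
  ≡⟨ ∑-swap (range n) (range n) _ ⟩
    ∑ (range n) (λ i → ∑ (range n) λ a → ∑ (range n) λ j → ∑ (range n) λ l → ind ⌊ a ℕ.+ l ℕ.≟ n ⌋ (ind ⌊ i ℕ.+ j ℕ.≟ a ⌋ (f i * g j * h l)))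
  ≡⟨ ∑-cong (range n) (λ i → ∑-swap (range n) (range n) _) ⟩
    ∑ (range n) (λ i → ∑ (range n) λ j → ∑ (range n) λ a → ∑ (range n) λ l → ind ⌊ a ℕ.+ l ℕ.≟ n ⌋ (ind ⌊ i ℕ.+ j ℕ.≟ a ⌋ (f i * g j * h l)))
  ≡⟨ ∑-cong (range n) (λ i → ∑-cong (range n) λ j → ∑-swap (range n) (range n) _) ⟩
    ∑ (range n) (λ i → ∑ (range n) λ j → ∑ (range n) λ l → ∑ (range n) λ a → ind ⌊ a ℕ.+ l ℕ.≟ n ⌋ (ind ⌊ i ℕ.+ j ℕ.≟ a ⌋ (f i * g j * h l)))
  ≡⟨ ∑-cong (range n) (λ i → ∑-cong (range n) λ j → ∑-cong (range n) λ l → collapse i j l) ⟩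
    ⊛₃ f g h n
  ∎
  where
  open ≡-Reasoning
  expand : ∀ a l → ⊛₂ᴮ (suc n) f g a * h l ≡ ∑ (range n) (λ i → ∑ (range n) λ j → ind ⌊ i ℕ.+ j ℕ.≟ a ⌋ (f i * g j * h l))
  expand a l = trans (sym (∑-*ʳ (range n) (h l) _)) (∑-cong (range n) λ i → trans (sym (∑-*ʳ (range n) (h l) _))
                 (∑-cong (range n) λ j → ind-*ʳ ⌊ i ℕ.+ j ℕ.≟ a ⌋ (f i * g j) (h l)))
  collapse : ∀ i j l → ∑ (range n) (λ a → ind ⌊ a ℕ.+ l ℕ.≟ n ⌋ (ind ⌊ i ℕ.+ j ℕ.≟ a ⌋ (f i * g j * h l)))
                     ≡ ind ⌊ i ℕ.+ j ℕ.+ l ℕ.≟ n ⌋ (f i * g j * h l)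
  collapse i j l = trans (∑-cong (range n) λ a → swapind a)
      (trans (∑-upTo-select (suc n) (i ℕ.+ j) _) fin)
    where
    w = f i * g j * h l
    swapind : ∀ a → ind ⌊ a ℕ.+ l ℕ.≟ n ⌋ (ind ⌊ i ℕ.+ j ℕ.≟ a ⌋ w) ≡ ind ⌊ a ℕ.≟ i ℕ.+ j ⌋ (ind ⌊ i ℕ.+ j ℕ.+ l ℕ.≟ n ⌋ w)
    swapind a with i ℕ.+ j ℕ.≟ a | a ℕ.≟ i ℕ.+ j
    ... | yes refl | yes _ = refl
    ... | yes refl | no ne = ⊥-elim (ne refl)
    ... | no ne | yes e = ⊥-elim (ne (sym e))
    ... | no ne | no _ with a ℕ.+ l ℕ.≟ n
    ... | yes _ = refl
    ... | no _ = refl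
    fin : ind ⌊ i ℕ.+ j ℕ.<? suc n ⌋ (ind ⌊ i ℕ.+ j ℕ.+ l ℕ.≟ n ⌋ w) ≡ ind ⌊ i ℕ.+ j ℕ.+ l ℕ.≟ n ⌋ w
    fin with i ℕ.+ j ℕ.+ l ℕ.≟ n
    ... | yes e = ind-yes (i ℕ.+ j ℕ.<? suc n) (s≤s (ℕP.≤-trans (ℕP.m≤m+n (i ℕ.+ j) l) (ℕP.≤-reflexive e))) w
    ... | no _ with i ℕ.+ j ℕ.<? suc n
    ... | yes _ = refl
    ... | no _ = refl

⊛₃-rotate : ∀ f g h n → ⊛₃ f g h n ≡ ⊛₃ g h f n
⊛₃-rotate f g h n =
  begin
    ∑ (range n) (λ i → ∑ (range n) λ j → ∑ (range n) λ l → ind ⌊ i ℕ.+ j ℕ.+ l ℕ.≟ n ⌋ (f i * g j * h l))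
  ≡⟨ ∑-swap (range n) (range n) _ ⟩
    ∑ (range n) (λ j → ∑ (range n) λ i → ∑ (range n) λ l → ind ⌊ i ℕ.+ j ℕ.+ l ℕ.≟ n ⌋ (f i * g j * h l))
  ≡⟨ ∑-cong (range n) (λ j → ∑-swap (range n) (range n) _) ⟩
    ∑ (range n) (λ j → ∑ (range n) λ l → ∑ (range n) λ i → ind ⌊ i ℕ.+ j ℕ.+ l ℕ.≟ n ⌋ (f i * g j * h l))
  ≡⟨ ∑-cong (range n) (λ j → ∑-cong (range n) λ l → ∑-cong (range n) λ i →
       trans (ind-iff (i ℕ.+ j ℕ.+ l ℕ.≟ n) (j ℕ.+ l ℕ.+ i ℕ.≟ n) (λ e → trans (sym (p i j l)) e) (λ e → trans (p i j l) e) _)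
             (ind-cong ⌊ j ℕ.+ l ℕ.+ i ℕ.≟ n ⌋ (q (f i) (g j) (h l)))) ⟩
    ∑ (range n) (λ j → ∑ (range n) λ l → ∑ (range n) λ i → ind ⌊ j ℕ.+ l ℕ.+ i ℕ.≟ n ⌋ (g j * h l * f i))
  ∎
  where
  open ≡-Reasoning
  p : ∀ i j l → i ℕ.+ j ℕ.+ l ≡ j ℕ.+ l ℕ.+ i
  p i j l = trans (ℕP.+-assoc i j l) (ℕP.+-comm i (j ℕ.+ l))
  q : ∀ a b c → a * b * c ≡ b * c * a
  q a b c = trans (ℤP.*-assoc a b c) (ℤP.*-comm a (b * c))

⊛-assoc : ∀ f g h → ((f ⊛ g) ⊛ h) ≈ (f ⊛ (g ⊛ h))
⊛-assoc f g h n = trans (⊛⊛≡⊛₃ f g h n) (trans (⊛₃-rotate f g h n)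
   (trans (sym (⊛⊛≡⊛₃ g h f n)) (⊛-comm (g ⊛ h) f n)))

⊛₃-cong : ∀ {f f' g g' h h'} → f ≈ f' → g ≈ g' → h ≈ h' → ∀ n → ⊛₃ f g h n ≡ ⊛₃ f' g' h' n
⊛₃-cong ef eg eh n = ∑-cong (range n) (λ a → ∑-cong (range n) λ b → ∑-cong (range n) λ c → cong (ind _) (cong₂ _*_ (cong₂ _*_ (ef a) (eg b)) (eh c)))

⊛₃-∑₁ : ∀ {A : Set} (xs : List A) (φ : A → Series) G H n → ⊛₃ (λ a → ∑ xs (λ p → φ p a)) G H n ≡ ∑ xs (λ p → ⊛₃ (φ p) G H n)
⊛₃-∑₁ xs φ G H n =
  begin
    ∑ (range n) (λ a → ∑ (range n) λ b → ∑ (range n) λ c → ind ⌊ a ℕ.+ b ℕ.+ c ℕ.≟ n ⌋ (∑ xs (λ p → φ p a) * G b * H c))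
  ≡⟨ ∑-cong (range n) (λ a → ∑-cong (range n) λ b → ∑-cong (range n) λ c → trans (cong (ind ⌊ a ℕ.+ b ℕ.+ c ℕ.≟ n ⌋)
        (trans (cong (_* H c) (sym (∑-*ʳ xs (G b) (λ p → φ p a)))) (sym (∑-*ʳ xs (H c) (λ p → φ p a * G b))))) (sym
            (∑-ind xs ⌊ a ℕ.+ b ℕ.+ c ℕ.≟ n ⌋ _))) ⟩
    ∑ (range n) (λ a → ∑ (range n) λ b → ∑ (range n) λ c → ∑ xs λ p → ind ⌊ a ℕ.+ b ℕ.+ c ℕ.≟ n ⌋ (φ p a * G b * H c))
  ≡⟨ ∑-cong (range n) (λ a → ∑-cong (range n) λ b → ∑-swap (range n) xs _) ⟩
    ∑ (range n) (λ a → ∑ (range n) λ b → ∑ xs λ p → ∑ (range n) λ c → ind ⌊ a ℕ.+ b ℕ.+ c ℕ.≟ n ⌋ (φ p a * G b * H c))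
  ≡⟨ ∑-cong (range n) (λ a → ∑-swap (range n) xs _) ⟩
    ∑ (range n) (λ a → ∑ xs λ p → ∑ (range n) λ b → ∑ (range n) λ c → ind ⌊ a ℕ.+ b ℕ.+ c ℕ.≟ n ⌋ (φ p a * G b * H c))
  ≡⟨ ∑-swap (range n) xs _ ⟩
    ∑ xs (λ p → ⊛₃ (φ p) G H n)
  ∎
  where open ≡-Reasoning

⊛₃-∑₂ : ∀ {A : Set} (xs : List A) F (γ : A → Series) H n → ⊛₃ F (λ b → ∑ xs (λ p → γ p b)) H n ≡ ∑ xs (λ p → ⊛₃ F (γ p) H n)
⊛₃-∑₂ xs F γ H n = trans (⊛₃-rotate F _ H n) (trans (⊛₃-∑₁ xs γ H F n)
   (∑-cong xs (λ p → trans (⊛₃-rotate (γ p) H F n) (⊛₃-rotate H F (γ p) n))))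

⊛₃-∑₃ : ∀ {A : Set} (xs : List A) F G (η : A → Series) n → ⊛₃ F G (λ c → ∑ xs (λ p → η p c)) n ≡ ∑ xs (λ p → ⊛₃ F G (η p) n)
⊛₃-∑₃ xs F G η n = trans (⊛₃-rotate F G _ n) (trans (⊛₃-rotate G _ F n) (trans (⊛₃-∑₁ xs η F G n)
   (∑-cong xs (λ p → ⊛₃-rotate (η p) F G n))))

ind³-* : ∀ x y z w → ind w (ind x 1ℤ * ind y 1ℤ * ind z 1ℤ) ≡ ind x (ind y (ind z (ind w 1ℤ)))
ind³-* false y z w = ind-zero w
ind³-* true false z w = ind-zero w
ind³-* true true false w = ind-zero w
ind³-* true true true w = refl

⊛₃-indicators : ∀ d1 d2 d3 s1 s2 s3 n → ⊛₃ (λ a → ind (d1 ∧ ⌊ s1 ℕ.≟ a ⌋) 1ℤ) (λ b → ind (d2 ∧ ⌊ s2 ℕ.≟ b ⌋) 1ℤ) (λ c → ind (d3 ∧ ⌊ s3 ℕ.≟ c ⌋) 1ℤ) n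
                              ≡ ind (d1 ∧ (d2 ∧ (d3 ∧ ⌊ s1 ℕ.+ s2 ℕ.+ s3 ℕ.≟ n ⌋))) 1ℤ
⊛₃-indicators d1 d2 d3 s1 s2 s3 n = trans (∑-cong (range n) (λ a → ∑-cong (range n) λ b → ∑-cong (range n) λ c → ind³-* (d1 ∧ ⌊ s1 ℕ.≟ a ⌋)
    (d2 ∧ ⌊ s2 ℕ.≟ b ⌋) (d3 ∧ ⌊ s3 ℕ.≟ c ⌋) _)) (cases d1 d2 d3)
  where
  nested : Bool → Bool → Bool → ℤ
  nested d1 d2 d3 = ∑ (range n) (λ a → ∑ (range n) λ b → ∑ (range n) λ c → ind (d1 ∧ ⌊ s1 ℕ.≟ a ⌋) (ind (d2 ∧ ⌊ s2 ℕ.≟ b ⌋) (ind (d3 ∧ ⌊ s3 ℕ.≟ c ⌋)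
      (ind ⌊ a ℕ.+ b ℕ.+ c ℕ.≟ n ⌋ 1ℤ))))
  ∑³-vanish : ∀ (h : ℕ → ℕ → ℕ → ℤ) → (∀ a b c → h a b c ≡ 0ℤ) → ∑ (range n) (λ a → ∑ (range n) λ b → ∑ (range n) λ c → h a b c) ≡ 0ℤ
  ∑³-vanish h e = ∑-vanish (range n) (λ a → ∑-vanish (range n) λ b → ∑-vanish (range n) λ c → e a b c)
  cases : ∀ d1 d2 d3 → nested d1 d2 d3 ≡ ind (d1 ∧ (d2 ∧ (d3 ∧ ⌊ s1 ℕ.+ s2 ℕ.+ s3 ℕ.≟ n ⌋))) 1ℤ
  cases false d2 d3 = ∑³-vanish _ (λ a b c → refl)
  cases true false d3 = ∑³-vanish _ (λ a b c → ind-zero _)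
  cases true true false = ∑³-vanish _ (λ a b c → trans (cong (ind ⌊ s1 ℕ.≟ a ⌋) (ind-zero _)) (ind-zero _))
  cases true true true =
    begin
      ∑ (range n) (λ a → ∑ (range n) λ b → ∑ (range n) λ c → ind ⌊ s1 ℕ.≟ a ⌋ (ind ⌊ s2 ℕ.≟ b ⌋ (ind ⌊ s3 ℕ.≟ c ⌋ (ind ⌊ a ℕ.+ b ℕ.+ c ℕ.≟ n ⌋ 1ℤ))))
    ≡⟨ ∑-cong (range n) (λ a → trans (∑-cong (range n) λ b → trans (∑-ind (range n) ⌊ s1 ℕ.≟ a ⌋ _) (cong (ind ⌊ s1 ℕ.≟ a ⌋) (∑-ind
        (range n) ⌊ s2 ℕ.≟ b ⌋ _))) (∑-ind (range n) ⌊ s1 ℕ.≟ a ⌋ _)) ⟩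
      ∑ (range n) (λ a → ind ⌊ s1 ℕ.≟ a ⌋ (∑ (range n) λ b → ind ⌊ s2 ℕ.≟ b ⌋ (∑ (range n) λ c → ind ⌊ s3 ℕ.≟ c ⌋ (ind ⌊ a ℕ.+ b ℕ.+ c ℕ.≟ n ⌋ 1ℤ))))
    ≡⟨ ∑-cong (range n) (λ a → cong (ind ⌊ s1 ℕ.≟ a ⌋) (∑-cong (range n) λ b → cong (ind ⌊ s2 ℕ.≟ b ⌋) (∑-upTo-select′ (suc n) s3
        (λ c → ind ⌊ a ℕ.+ b ℕ.+ c ℕ.≟ n ⌋ 1ℤ)))) ⟩
      ∑ (range n) (λ a → ind ⌊ s1 ℕ.≟ a ⌋ (∑ (range n) λ b → ind ⌊ s2 ℕ.≟ b ⌋ (ind ⌊ s3 ℕ.<? suc n ⌋ (ind ⌊ a ℕ.+ b ℕ.+ s3 ℕ.≟ n ⌋ 1ℤ))))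
    ≡⟨ ∑-cong (range n) (λ a → cong (ind ⌊ s1 ℕ.≟ a ⌋) (∑-upTo-select′ (suc n) s2 (λ b → ind ⌊ s3 ℕ.<? suc n ⌋ (ind ⌊ a ℕ.+ b ℕ.+ s3 ℕ.≟ n ⌋ 1ℤ)))) ⟩
      ∑ (range n) (λ a → ind ⌊ s1 ℕ.≟ a ⌋ (ind ⌊ s2 ℕ.<? suc n ⌋ (ind ⌊ s3 ℕ.<? suc n ⌋ (ind ⌊ a ℕ.+ s2 ℕ.+ s3 ℕ.≟ n ⌋ 1ℤ))))
    ≡⟨ ∑-upTo-select′ (suc n) s1 (λ a → ind ⌊ s2 ℕ.<? suc n ⌋ (ind ⌊ s3 ℕ.<? suc n ⌋ (ind ⌊ a ℕ.+ s2 ℕ.+ s3 ℕ.≟ n ⌋ 1ℤ))) ⟩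
      ind ⌊ s1 ℕ.<? suc n ⌋ (ind ⌊ s2 ℕ.<? suc n ⌋ (ind ⌊ s3 ℕ.<? suc n ⌋ (ind ⌊ s1 ℕ.+ s2 ℕ.+ s3 ℕ.≟ n ⌋ 1ℤ)))
    ≡⟨ fin ⟩
      ind ⌊ s1 ℕ.+ s2 ℕ.+ s3 ℕ.≟ n ⌋ 1ℤ
    ∎
    where
    open ≡-Reasoning
    fin : ind ⌊ s1 ℕ.<? suc n ⌋ (ind ⌊ s2 ℕ.<? suc n ⌋ (ind ⌊ s3 ℕ.<? suc n ⌋
        (ind ⌊ s1 ℕ.+ s2 ℕ.+ s3 ℕ.≟ n ⌋ 1ℤ))) ≡ ind ⌊ s1 ℕ.+ s2 ℕ.+ s3 ℕ.≟ n ⌋ 1ℤ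
    fin with s1 ℕ.+ s2 ℕ.+ s3 ℕ.≟ n
    ... | no _ = trans (cong (ind ⌊ s1 ℕ.<? suc n ⌋) (trans (cong (ind ⌊ s2 ℕ.<? suc n ⌋) (ind-zero ⌊ s3 ℕ.<? suc n ⌋)) (ind-zero ⌊ s2 ℕ.<? suc n ⌋)))
        (ind-zero ⌊ s1 ℕ.<? suc n ⌋)
    ... | yes e = trans (ind-yes (s1 ℕ.<? suc n) (s≤s (ℕP.≤-trans (ℕP.≤-trans (ℕP.m≤m+n s1 s2) (ℕP.m≤m+n (s1 ℕ.+ s2) s3)) (ℕP.≤-reflexive e))) _)
                  (trans (ind-yes (s2 ℕ.<? suc n) (s≤s (ℕP.≤-trans (ℕP.≤-trans (ℕP.m≤n+m s2 s1) (ℕP.m≤m+n (s1 ℕ.+ s2) s3)) (ℕP.≤-reflexive e))) _)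
                  (ind-yes (s3 ℕ.<? suc n) (s≤s (ℕP.≤-trans (ℕP.m≤n+m s3 (s1 ℕ.+ s2)) (ℕP.≤-reflexive e))) _))

⊛-∑-ind : ∀ {A : Set} (t : Series) (xs : List A) (B : A → Bool) (F : A → Series) n →
  (t ⊛ (λ m → ∑ xs (λ x → ind (B x) (F x m)))) n ≡ ∑ xs (λ x → ind (B x) ((t ⊛ F x) n))
⊛-∑-ind t xs B F n = trans (⊛-∑ t (λ m → ∑ xs (λ x → ind (B x) (F x m))) n) (trans (∑-cong (range n) (λ i → trans (sym (∑-*ˡ xs (t i) (λ x → ind (B x)
    (F x (n ∸ i))))) (∑-cong xs (λ x → ind-*ˡ (B x) (F x (n ∸ i)) (t i)))))
  (trans (∑-swap (range n) xs (λ i x → ind (B x) (t i * F x (n ∸ i)))) (∑-cong xs (λ x → trans (∑-ind (range n) (B x) (λ i → t i * F x (n ∸ i))) (cong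
      (ind (B x)) (sym (⊛-∑ t (F x) n)))))))

⊛-∑ˡ : ∀ {A : Set} (xs : List A) (F : A → Series) G n → ((λ i → ∑ xs (λ x → F x i)) ⊛ G) n ≡ ∑ xs (λ x → (F x ⊛ G) n)
⊛-∑ˡ xs F G n = trans (⊛-comm (λ i → ∑ xs (λ x → F x i)) G n) (trans (⊛-∑-ind G xs (λ _ → true) F n) (∑-cong xs (λ x → ⊛-comm G (F x) n)))

⊛-∑ʳ : ∀ {A : Set} (xs : List A) F (G : A → Series) n → (F ⊛ (λ j → ∑ xs (λ x → G x j))) n ≡ ∑ xs (λ x → (F ⊛ G x) n)
⊛-∑ʳ xs F G n = ⊛-∑-ind F xs (λ _ → true) G n

⊛-*ˡ : ∀ c F G n → ((λ i → c * F i) ⊛ G) n ≡ c * (F ⊛ G) n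
⊛-*ˡ c F G n = trans (⊛-∑ (λ i → c * F i) G n) (trans (∑-cong (range n) (λ i → ℤP.*-assoc c (F i) (G (n ∸ i)))) (trans (∑-*ˡ (range n) c _) (cong
    (c *_) (sym (⊛-∑ F G n)))))

⊛-*ʳ : ∀ c F G n → (F ⊛ (λ j → c * G j)) n ≡ c * (F ⊛ G) n
⊛-*ʳ c F G n = trans (⊛-comm F (λ j → c * G j) n) (trans (⊛-*ˡ c G F n) (cong (c *_) (⊛-comm G F n)))

⊛-cong-≤ʳ : ∀ F G G' n → (∀ j → j ≤ n → G j ≡ G' j) → (F ⊛ G) n ≡ (F ⊛ G') n
⊛-cong-≤ʳ F G G' n e = trans (⊛-∑ F G n) (trans (∑-upTo-cong (suc n) (λ i _ → cong (F i *_) (e (n ∸ i) (ℕP.m∸n≤m n i)))) (sym (⊛-∑ F G' n)))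

⊛-cong-≤ˡ : ∀ F F' G n → (∀ j → j ≤ n → F j ≡ F' j) → (F ⊛ G) n ≡ (F' ⊛ G) n
⊛-cong-≤ˡ F F' G n e = trans (⊛-comm F G n) (trans (⊛-cong-≤ʳ G F F' n e) (⊛-comm G F' n))

⊛-vanishˡ : ∀ F G j → (∀ i → i ≤ j → F i ≡ 0ℤ) → (F ⊛ G) j ≡ 0ℤ
⊛-vanishˡ F G j e = trans (⊛-∑ F G j) (trans (∑-upTo-cong (suc j) (λ i lt → trans (cong (_* G (j ∸ i)) (e i (ℕP.≤-pred lt))) (ℤP.*-zeroˡ (G
    (j ∸ i))))) (∑-zero (range j)))

⊛-vanishʳ : ∀ F G j → (∀ i → i ≤ j → G i ≡ 0ℤ) → (F ⊛ G) j ≡ 0ℤ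
⊛-vanishʳ F G j e = trans (⊛-comm F G j) (⊛-vanishˡ G F j e)

prodS-++ : ∀ xs ys → prodS (xs ++ ys) ≈ (prodS xs ⊛ prodS ys)
prodS-++ [] ys = ≈-sym (⊛-oneˡ (prodS ys))
prodS-++ (x ∷ xs) ys = ≈-trans (⊛-congʳ x (prodS-++ xs ys)) (≈-sym (⊛-assoc x (prodS xs) (prodS ys)))

negS : Series → Series
negS f n = - f n

constS : ℤ → Series
constS c zero = c
constS c (suc _) = 0ℤ

constS-⊛ : ∀ a G n → (constS a ⊛ G) n ≡ a * G n
constS-⊛ a G n = trans (⊛-∑ (constS a) G n) (trans (∑-upTo-suc n _) (trans (cong (_+_ (a * G n)) (∑-vanish (upTo n) (λ i → ℤP.*-zeroˡ (G
    (n ℕ.∸ suc i))))) (ℤP.+-identityʳ _)))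

constS-0 : constS 0ℤ ≈ zeroS
constS-0 zero = refl
constS-0 (suc n) = refl

constS-1 : constS 1ℤ ≈ oneS
constS-1 zero = refl
constS-1 (suc n) = refl

negS-⊛ : ∀ f g n → (negS f ⊛ g) n ≡ - (f ⊛ g) n
negS-⊛ f g n = trans (⊛-∑ (negS f) g n) (trans (∑-cong (range n) (λ i → sym (ℤP.neg-distribˡ-* (f i) (g (n ∸ i))))) (trans (∑-neg (range n) _)
    (cong -_ (sym (⊛-∑ f g n)))))

i*n/ℕn≡i : ∀ i n .{{_ : ℕ.NonZero n}} → (i * + n) /ℕ n ≡ i
i*n/ℕn≡i i n@(suc _) = sym (quotient-unique (i - q) refl)
  where
  q = (i * + n) /ℕ n
  r = (i * + n) %ℕ n
  remainder : (i - q) * + n ≡ + r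
  remainder = begin
    (i - q) * + n           ≡⟨ alg i q (+ n) ⟩
    i * + n - q * + n       ≡⟨ cong (_- q * + n) (a≡a%ℕn+[a/ℕn]*n (i * + n) n) ⟩
    + r + q * + n - q * + n ≡⟨ alg′ (+ r) (q * + n) ⟩
    + r                     ∎
    where
    open ≡-Reasoning
    alg : ∀ i q n → (i - q) * n ≡ i * n - q * n
    alg = solve-∀
    alg′ : ∀ r x → r + x - x ≡ r
    alg′ = solve-∀
  quotient-unique : ∀ e → e ≡ i - q → i ≡ q
  quotient-unique (+ zero) e = trans (alg i q) (trans (cong (_+_ q) (sym e)) (ℤP.+-identityʳ q))
    where alg : ∀ i q → i ≡ q + (i - q)
          alg = solve-∀
  quotient-unique (+ suc k) e = ⊥-elim (ℕP.<⇒≱ (n%ℕd<d (i * + n) n) (begin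
    n               ≤⟨ ℕP.m≤m+n n (k ℕ.* n) ⟩
    suc k ℕ.* n     ≡⟨ ℤP.+-injective (trans (ℤP.pos-* (suc k) n) (trans (cong (_* + n) e) remainder)) ⟩
    r               ∎))
    where open ℕP.≤-Reasoning
  quotient-unique -[1+ k ] e with trans (cong (_* + n) e) remainder
  ... | ()

falling-suc : ∀ y j → fallingℤ (y + 1ℤ) (suc j) ≡ (y + 1ℤ) * fallingℤ y j
falling-suc y zero = alg y
  where alg : ∀ y → 1ℤ * (y + 1ℤ - 0ℤ) ≡ (y + 1ℤ) * 1ℤ
        alg = solve-∀
falling-suc y (suc j) = trans (cong (_* (y + 1ℤ - + suc j)) (falling-suc y j)) (alg y (fallingℤ y j) (+ j))
  where alg : ∀ y f j → (y + 1ℤ) * f * (y + 1ℤ - (1ℤ + j)) ≡ (y + 1ℤ) * (f * (y - j))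
        alg = solve-∀

falling-pascal : ∀ y j → fallingℤ (y + 1ℤ) (suc j) ≡ fallingℤ y (suc j) + + suc j * fallingℤ y j
falling-pascal y j = trans (falling-suc y j) (alg y (fallingℤ y j) (+ j))
  where alg : ∀ y f j → (y + 1ℤ) * f ≡ f * (y - j) + (1ℤ + j) * f
        alg = solve-∀

falling-zero : ∀ j → fallingℤ 0ℤ (suc j) ≡ 0ℤ
falling-zero zero = refl
falling-zero (suc j) = trans (cong (_* (0ℤ - + suc j)) (falling-zero j)) (ℤP.*-zeroˡ (0ℤ - + suc j))

falling-vanish : ∀ i j → i < j → fallingℤ (+ i) j ≡ 0ℤ
falling-vanish i (suc j) lt with i ℕ.≟ j
... | yes refl = trans (cong (fallingℤ (+ i) i *_) (ℤP.+-inverseʳ (+ i))) (ℤP.*-zeroʳ (fallingℤ (+ i) i))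
... | no ne = trans (cong (_* (+ i - + j)) (falling-vanish i j (ℕP.≤∧≢⇒< (ℕP.≤-pred lt) ne))) (ℤP.*-zeroˡ (+ i - + j))

FactorialMultiple : ℤ → ℕ → Set
FactorialMultiple x j = Σ ℤ λ c → x ≡ c * + (j !)

module _ (y : ℤ) (j : ℕ) (c c′ : ℤ) where

  private
    distrib : ∀ a b → a * + (suc j !) + + suc j * (b * + (j !)) ≡ (a + b) * + (suc j !)
    distrib a b = begin
      a * + (suc j !) + + suc j * (b * + (j !))         ≡⟨ cong (λ z → a * z + + suc j * (b * + (j !))) fact ⟩
      a * (+ suc j * + (j !)) + + suc j * (b * + (j !)) ≡⟨ alg a b (+ suc j) (+ (j !)) ⟩
      (a + b) * (+ suc j * + (j !))                     ≡⟨ cong ((a + b) *_) fact ⟨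
      (a + b) * + (suc j !)                             ∎
      where
      open ≡-Reasoning
      fact : + (suc j !) ≡ + suc j * + (j !)
      fact = ℤP.pos-* (suc j) (j !)
      alg : ∀ a b s f → a * (s * f) + s * (b * f) ≡ (a + b) * (s * f)
      alg = solve-∀

  falling-quotient-suc : fallingℤ y (suc j) ≡ c * + (suc j !) → fallingℤ y j ≡ c′ * + (j !) →
                         fallingℤ (y + 1ℤ) (suc j) ≡ (c + c′) * + (suc j !)
  falling-quotient-suc e e′ = trans (falling-pascal y j)
    (trans (cong₂ (λ u v → u + + suc j * v) e e′) (distrib c c′))

  falling-quotient-pred : fallingℤ (y + 1ℤ) (suc j) ≡ c * + (suc j !) → fallingℤ y j ≡ c′ * + (j !) →
                          fallingℤ y (suc j) ≡ (c - c′) * + (suc j !)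
  falling-quotient-pred e e′ = begin
    fallingℤ y (suc j)                                          ≡⟨ alg (fallingℤ y (suc j)) (+ suc j * fallingℤ y j) ⟩
    fallingℤ y (suc j) + + suc j * fallingℤ y j - + suc j * fallingℤ y j
      ≡⟨ cong₂ (λ u v → u - + suc j * v) (trans (sym (falling-pascal y j)) e) e′ ⟩
    c * + (suc j !) - + suc j * (c′ * + (j !))                  ≡⟨ alg′ (c * + (suc j !)) (+ suc j) c′ (+ (j !)) ⟩
    c * + (suc j !) + + suc j * (- c′ * + (j !))                ≡⟨ distrib c (- c′) ⟩
    (c - c′) * + (suc j !)                                      ∎
    where
    open ≡-Reasoning
    alg : ∀ a b → a ≡ a + b - b
    alg = solve-∀
    alg′ : ∀ a s c f → a - s * (c * f) ≡ a + s * (- c * f)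
    alg′ = solve-∀

falling-factorialMultiple : ∀ j y → FactorialMultiple (fallingℤ y j) j
falling-factorialMultiple zero y = 1ℤ , refl
falling-factorialMultiple (suc j) = ℤ-induction (λ y → FactorialMultiple (fallingℤ y (suc j)) (suc j))
  (0ℤ , falling-zero j)
  (λ { y (c , e) → let c′ , e′ = falling-factorialMultiple j y in c + c′ , falling-quotient-suc y j c c′ e e′ })
  (λ { y (c , e) → let c′ , e′ = falling-factorialMultiple j y in c - c′ , falling-quotient-pred y j c c′ e e′ })
  where
  ℤ-induction : (P : ℤ → Set) → P 0ℤ → (∀ y → P y → P (y + 1ℤ)) → (∀ y → P (y + 1ℤ) → P y) → ∀ y → P y
  ℤ-induction P p₀ up down (+ zero) = p₀
  ℤ-induction P p₀ up down (+ suc n) = subst P (ℤP.+-comm (+ n) 1ℤ) (up (+ n) (ℤ-induction P p₀ up down (+ n)))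
  ℤ-induction P p₀ up down -[1+ zero ] = down -[1+ zero ] p₀
  ℤ-induction P p₀ up down -[1+ suc n ] = down -[1+ suc n ] (ℤ-induction P p₀ up down -[1+ n ])

binom-exact : ∀ y j c → fallingℤ y j ≡ c * + (j !) → binom y j ≡ c
binom-exact y j c e = trans (cong (λ z → _/ℕ_ z (j !) {{j ℕP.!≢0}}) e) (i*n/ℕn≡i c (j !) {{j ℕP.!≢0}})

binom-pascal : ∀ y j → binom (y + 1ℤ) (suc j) ≡ binom y (suc j) + binom y j
binom-pascal y j with falling-factorialMultiple (suc j) (y + 1ℤ) | falling-factorialMultiple (suc j) y | falling-factorialMultiple j y
... | c₁ , e₁ | c₂ , e₂ | c₃ , e₃ = begin
  binom (y + 1ℤ) (suc j)        ≡⟨ binom-exact (y + 1ℤ) (suc j) c₁ e₁ ⟩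
  c₁                            ≡⟨ ℤP.*-cancelʳ-≡ c₁ (c₂ + c₃) (+ (suc j !)) {{suc j ℕP.!≢0}}
                                     (trans (sym e₁) (falling-quotient-suc y j c₂ c₃ e₂ e₃)) ⟩
  c₂ + c₃                       ≡⟨ cong₂ _+_ (binom-exact y (suc j) c₂ e₂) (binom-exact y j c₃ e₃) ⟨
  binom y (suc j) + binom y j   ∎
  where open ≡-Reasoning

Δ² : (ℤ → ℤ) → ℤ → ℤ
Δ² f m = f (m + 1ℤ) + f (m - 1ℤ) - (f m + f m)

Δ²-cong : ∀ {f g} → (∀ x → f x ≡ g x) → ∀ m → Δ² f m ≡ Δ² g m
Δ²-cong e m = cong₂ _-_ (cong₂ _+_ (e _) (e _)) (cong₂ _+_ (e m) (e m))

Δ²-binom : ∀ j y → Δ² (λ x → binom x (2 ℕ.+ j)) y ≡ binom (y - 1ℤ) j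
Δ²-binom j y = begin
  b₂ (y + 1ℤ) + b₂ (y - 1ℤ) - (b₂ y + b₂ y)
    ≡⟨ cong (λ z → b₂ (y + 1ℤ) + b₂ (y - 1ℤ) - (b₂ z + b₂ y)) (sym (alg₀ y)) ⟩
  b₂ (y + 1ℤ) + b₂ (y - 1ℤ) - (b₂ (y - 1ℤ + 1ℤ) + b₂ y)
    ≡⟨ cong₂ (λ u v → u + b₂ (y - 1ℤ) - (v + b₂ y)) (binom-pascal y (suc j)) (binom-pascal (y - 1ℤ) (suc j)) ⟩
  b₂ y + b₁ y + b₂ (y - 1ℤ) - (b₂ (y - 1ℤ) + b₁ (y - 1ℤ) + b₂ y)
    ≡⟨ alg₁ (b₂ y) (b₁ y) (b₂ (y - 1ℤ)) (b₁ (y - 1ℤ)) ⟩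
  b₁ y - b₁ (y - 1ℤ)
    ≡⟨ cong (λ z → b₁ z - b₁ (y - 1ℤ)) (sym (alg₀ y)) ⟩
  b₁ (y - 1ℤ + 1ℤ) - b₁ (y - 1ℤ)
    ≡⟨ cong (_- b₁ (y - 1ℤ)) (binom-pascal (y - 1ℤ) j) ⟩
  b₁ (y - 1ℤ) + binom (y - 1ℤ) j - b₁ (y - 1ℤ)
    ≡⟨ alg₂ (b₁ (y - 1ℤ)) (binom (y - 1ℤ) j) ⟩
  binom (y - 1ℤ) j
    ∎
  where
  open ≡-Reasoning
  b₁ b₂ : ℤ → ℤ
  b₁ x = binom x (suc j)
  b₂ x = binom x (suc (suc j))
  alg₀ : ∀ y → y - 1ℤ + 1ℤ ≡ y
  alg₀ = solve-∀
  alg₁ : ∀ a b c d → a + b + c - (c + d + a) ≡ b - d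
  alg₁ = solve-∀
  alg₂ : ∀ a b → a + b - a ≡ b
  alg₂ = solve-∀

binomWeight : ℕ → ℤ → ℤ
binomWeight k m = binom (m + + k - 1ℤ) (2 ℕ.* k)

binomWeight-at-0 : ∀ k → binomWeight (suc k) 0ℤ ≡ 0ℤ
binomWeight-at-0 k = binom-exact (0ℤ + + suc k - 1ℤ) (2 ℕ.* suc k) 0ℤ
  (trans (cong (λ z → fallingℤ z (2 ℕ.* suc k)) (shift k)) (falling-vanish k (2 ℕ.* suc k) (ℕP.m≤m+n (suc k) _)))
  where
  shift : ∀ k → 0ℤ + + suc k - 1ℤ ≡ + k
  shift zero = refl
  shift (suc k) = refl

Δ²-binomWeight : ∀ k m → Δ² (binomWeight (suc k)) m ≡ binomWeight k m
Δ²-binomWeight k m = begin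
  Δ² (binomWeight (suc k)) m
    ≡⟨ Δ²-cong (λ x → cong b (alg x (+ k))) m ⟩
  Δ² (λ x → b (x + + k)) m
    ≡⟨ cong₂ (λ u v → b u + b v - (b y + b y)) (alg₊ m (+ k)) (alg₋ m (+ k)) ⟩
  Δ² b y
    ≡⟨ cong (λ i → Δ² (λ x → binom x i) y) (ℕP.*-distribˡ-+ 2 1 k) ⟩
  Δ² (λ x → binom x (2 ℕ.+ 2 ℕ.* k)) y
    ≡⟨ Δ²-binom (2 ℕ.* k) y ⟩
  binomWeight k m
    ∎
  where
  open ≡-Reasoning
  y = m + + k
  b : ℤ → ℤ
  b x = binom x (2 ℕ.* suc k)
  alg : ∀ x k → x + (1ℤ + k) - 1ℤ ≡ x + k
  alg = solve-∀
  alg₊ : ∀ m k → m + 1ℤ + k ≡ m + k + 1ℤ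
  alg₊ = solve-∀
  alg₋ : ∀ m k → m - 1ℤ + k ≡ m + k - 1ℤ
  alg₋ = solve-∀

infix 4 _≋_
record _≋_ (f g : Series) : Set where
  constructor ≋i
  field ≋at : f ≈ g
open _≋_ public

infixl 6 _+ₛ_
infixl 7 _*ₛ_
infix 8 -ₛ_

-- Opaque: otherwise the ring solver's reflexivity proofs unfold Cauchy products, which is very slow.
opaque
  _+ₛ_ : Series → Series → Series
  f +ₛ g = f ⊕ g
  _*ₛ_ : Series → Series → Series
  f *ₛ g = f ⊛ g
  -ₛ_ : Series → Series
  -ₛ f = negS f
  +ₛ-def : ∀ f g → (f +ₛ g) ≈ (f ⊕ g)
  +ₛ-def f g n = refl
  *ₛ-def : ∀ f g → (f *ₛ g) ≈ (f ⊛ g)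
  *ₛ-def f g n = refl
  -ₛ-def : ∀ f → (-ₛ f) ≈ negS f
  -ₛ-def f n = refl
  +ₛ-cong : ∀ {x y u v} → x ≋ y → u ≋ v → (x +ₛ u) ≋ (y +ₛ v)
  +ₛ-cong e e' = ≋i (⊕-cong (≋at e) (≋at e'))
  +ₛ-assoc : ∀ f g h → ((f +ₛ g) +ₛ h) ≋ (f +ₛ (g +ₛ h))
  +ₛ-assoc f g h = ≋i (λ n → ℤP.+-assoc (f n) (g n) (h n))
  +ₛ-identityˡ : ∀ f → (zeroS +ₛ f) ≋ f
  +ₛ-identityˡ f = ≋i (λ n → ℤP.+-identityˡ (f n))
  +ₛ-identityʳ : ∀ f → (f +ₛ zeroS) ≋ f
  +ₛ-identityʳ f = ≋i (λ n → ℤP.+-identityʳ (f n))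
  -ₛ-inverseˡ : ∀ f → ((-ₛ f) +ₛ f) ≋ zeroS
  -ₛ-inverseˡ f = ≋i (λ n → ℤP.+-inverseˡ (f n))
  -ₛ-inverseʳ : ∀ f → (f +ₛ (-ₛ f)) ≋ zeroS
  -ₛ-inverseʳ f = ≋i (λ n → ℤP.+-inverseʳ (f n))
  -ₛ-cong : ∀ {x y} → x ≋ y → (-ₛ x) ≋ (-ₛ y)
  -ₛ-cong e = ≋i (λ n → cong -_ (≋at e n))
  +ₛ-comm : ∀ f g → (f +ₛ g) ≋ (g +ₛ f)
  +ₛ-comm f g = ≋i (λ n → ℤP.+-comm (f n) (g n))
  *ₛ-cong : ∀ {x y u v} → x ≋ y → u ≋ v → (x *ₛ u) ≋ (y *ₛ v)
  *ₛ-cong e e' = ≋i (⊛-cong (≋at e) (≋at e'))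
  *ₛ-assoc : ∀ f g h → ((f *ₛ g) *ₛ h) ≋ (f *ₛ (g *ₛ h))
  *ₛ-assoc f g h = ≋i (⊛-assoc f g h)
  *ₛ-identityˡ : ∀ f → (oneS *ₛ f) ≋ f
  *ₛ-identityˡ f = ≋i (⊛-oneˡ f)
  *ₛ-identityʳ : ∀ f → (f *ₛ oneS) ≋ f
  *ₛ-identityʳ f = ≋i (⊛-oneʳ f)
  *ₛ-distribˡ : ∀ f g h → (f *ₛ (g +ₛ h)) ≋ ((f *ₛ g) +ₛ (f *ₛ h))
  *ₛ-distribˡ f g h = ≋i (⊛-distribˡ f g h)
  *ₛ-distribʳ : ∀ f g h → ((g +ₛ h) *ₛ f) ≋ ((g *ₛ f) +ₛ (h *ₛ f))
  *ₛ-distribʳ f g h = ≋i (⊛-distribʳ f g h)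
  *ₛ-comm : ∀ f g → (f *ₛ g) ≋ (g *ₛ f)
  *ₛ-comm f g = ≋i (⊛-comm f g)
  constS-* : ∀ a b → constS (a * b) ≋ (constS a *ₛ constS b)
  constS-* a b = ≋i (λ n → sym (trans (constS-⊛ a (constS b) n) (lem a b n)))
    where
    lem : ∀ a b n → a * constS b n ≡ constS (a * b) n
    lem a b zero = refl
    lem a b (suc n) = ℤP.*-zeroʳ a
  constS-+ : ∀ a b → constS (a + b) ≋ (constS a +ₛ constS b)
  constS-+ a b = ≋i (λ { zero → refl ; (suc n) → refl })
  constS-neg : ∀ a → constS (- a) ≋ (-ₛ constS a)
  constS-neg a = ≋i (λ { zero → refl ; (suc n) → refl })

seriesRing : CommutativeRing _ _
seriesRing = record
  { Carrier = Series
  ; _≈_ = _≋_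
  ; _+_ = _+ₛ_
  ; _*_ = _*ₛ_
  ; -_ = -ₛ_
  ; 0# = zeroS
  ; 1# = oneS
  ; isCommutativeRing = record
    { isRing = record
      { +-isAbelianGroup = record
        { isGroup = record
          { isMonoid = record
            { isSemigroup = record
              { isMagma = record
                { isEquivalence = record { refl = ≋i (λ n → refl) ; sym = λ e → ≋i (≈-sym (≋at e)) ; trans = λ e e' → ≋i (≈-trans (≋at e) (≋at e')) }
                ; ∙-cong = +ₛ-cong }
              ; assoc = +ₛ-assoc }
            ; identity = +ₛ-identityˡ , +ₛ-identityʳ }
          ; inverse = -ₛ-inverseˡ , -ₛ-inverseʳ
          ; ⁻¹-cong = -ₛ-cong }
        ; comm = +ₛ-comm }
      ; *-cong = *ₛ-cong
      ; *-assoc = *ₛ-assoc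
      ; *-identity = *ₛ-identityˡ , *ₛ-identityʳ
      ; distrib = *ₛ-distribˡ , *ₛ-distribʳ }
    ; *-comm = *ₛ-comm } }

seriesACR : ACR.AlmostCommutativeRing _ _
seriesACR = ACR.fromCommutativeRing seriesRing

ℤ-rawRing : RawRing _ _
ℤ-rawRing = CommutativeRing.rawRing ℤP.+-*-commutativeRing

constS-morphism : ℤ-rawRing ACR.-Raw-AlmostCommutative⟶ seriesACR
constS-morphism = record
  { ⟦_⟧ = constS
  ; +-homo = constS-+
  ; *-homo = constS-*
  ; -‿homo = constS-neg
  ; 0-homo = ≋i constS-0
  ; 1-homo = ≋i constS-1 }

constS-≟ : ∀ a b → Maybe (constS a ≋ constS b)
constS-≟ a b with a ℤ.≟ b
... | yes refl = just (≋i (λ n → refl))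
... | no _ = nothing

open import Algebra.Solver.Ring ℤ-rawRing seriesACR constS-morphism constS-≟ using (solve; _:+_; _:*_; _:-_; _:=_; con)

open CommutativeRing seriesRing using (+-cong; *-cong; -‿cong; zeroʳ; +-identityʳ; *-assoc; *-identityˡ)
  renaming (refl to ≋-refl; _-_ to _-ₛ_; setoid to ≋-setoid; sym to ≋-sym; trans to ≋-trans)
module ≋-Reasoning = Relation.Binary.Reasoning.Setoid ≋-setoid

-- The number of partitions of s into exactly L parts, each at most b (below: into distinct parts).
partitions : ℕ → ℕ → ℕ → ℤ
partitions b zero s = ind ⌊ s ℕ.≟ 0 ⌋ 1ℤ
partitions zero (suc L) s = 0ℤ
partitions (suc b) (suc L) s = partitions b (suc L) s + ind ⌊ suc b ℕ.≤? s ⌋ (partitions (suc b) L (s ∸ suc b))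

strictPartitions : ℕ → ℕ → ℕ → ℤ
strictPartitions b zero s = ind ⌊ s ℕ.≟ 0 ⌋ 1ℤ
strictPartitions zero (suc L) s = 0ℤ
strictPartitions (suc b) (suc L) s = strictPartitions b (suc L) s + ind ⌊ suc b ℕ.≤? s ⌋ (strictPartitions b L (s ∸ suc b))

∸-suc< : ∀ b L s → suc b ≤ s → s < suc L → s ∸ suc b < L
∸-suc< b L s le lt = ℕP.≤-trans (ℕP.≤-reflexive (sym (ℕP.+-∸-assoc 1 le))) (ℕP.≤-trans (ℕP.m∸n≤m s b) (ℕP.≤-pred lt))

partitions-vanish : ∀ b L s → s < L → partitions b L s ≡ 0ℤ
partitions-vanish b (suc L) s lt with b
... | zero = refl
... | suc b' = trans (cong₂ _+_ (partitions-vanish b' (suc L) s lt)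
                      (trans (ind-case (suc b' ℕ.≤? s) (λ le → partitions-vanish (suc b') L (s ∸ suc b') (∸-suc< b' L s le lt))) (ind-zero _)))
                    refl

strictPartitions-vanish : ∀ b L s → s < L → strictPartitions b L s ≡ 0ℤ
strictPartitions-vanish b (suc L) s lt with b
... | zero = refl
... | suc b' = trans (cong₂ _+_ (strictPartitions-vanish b' (suc L) s lt)
                      (trans (ind-case (suc b' ℕ.≤? s) (λ le → strictPartitions-vanish b' L (s ∸ suc b') (∸-suc< b' L s le lt))) (ind-zero _)))
                    refl

partitionsWithPart : ℕ → ℕ → ℕ → ℤ
partitionsWithPart c zero i = 0ℤ
partitionsWithPart c (suc L) i = ind ⌊ c ℕ.≤? i ⌋ (partitions c L (i ∸ c))

partitions-suc : ∀ a L i → partitions (suc a) L i ≡ partitions a L i + partitionsWithPart (suc a) L i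
partitions-suc a zero i = sym (ℤP.+-identityʳ _)
partitions-suc a (suc L) i = refl

shift : ℕ → Series → Series
shift c F s = ind ⌊ c ℕ.≤? s ⌋ (F (s ∸ c))

shift≈monomial⊛ : ∀ c F → shift c F ≈ (monomial c ⊛ F)
shift≈monomial⊛ c F s = sym (trans (⊛-∑ (monomial c) F s) (trans (∑-cong (range s) (λ i → ind-*ʳ ⌊ i ℕ.≟ c ⌋ 1ℤ (F (s ∸ i))))
   (trans (∑-upTo-select (suc s) c (λ i → 1ℤ * F (s ∸ i)))
   (trans (ind-cong ⌊ c ℕ.<? suc s ⌋ (ℤP.*-identityˡ (F (s ∸ c))))
          (ind-iff (c ℕ.<? suc s) (c ℕ.≤? s) ℕP.≤-pred s≤s (F (s ∸ c)))))))

pairSeries : (ℕ → ℕ → ℤ) → (ℕ → ℕ → ℤ) → (ℤ → ℤ) → Series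
pairSeries P Q f s = ∑ (range s) λ i → ∑ (range s) λ L₂ → ∑ (range s) λ L₃ → f (+ L₂ - + L₃) * (P L₂ i * Q L₃ (s ∸ i))

pairSeries-congˡ : ∀ {P P′} Q f → (∀ L i → P L i ≡ P′ L i) → pairSeries P Q f ≈ pairSeries P′ Q f
pairSeries-congˡ Q f e s = ∑-cong (range s) λ i → ∑-cong (range s) λ L₂ → ∑-cong (range s) λ L₃ →
  cong (λ z → f (+ L₂ - + L₃) * (z * Q L₃ (s ∸ i))) (e L₂ i)

pairSeries-congʳ : ∀ P {Q Q′} f → (∀ L i → Q L i ≡ Q′ L i) → pairSeries P Q f ≈ pairSeries P Q′ f
pairSeries-congʳ P f e s = ∑-cong (range s) λ i → ∑-cong (range s) λ L₂ → ∑-cong (range s) λ L₃ →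
  cong (λ z → f (+ L₂ - + L₃) * (P L₂ i * z)) (e L₃ (s ∸ i))

pairSeries-+ˡ : ∀ P P′ Q f → pairSeries (λ L i → P L i + P′ L i) Q f ≈ (pairSeries P Q f ⊕ pairSeries P′ Q f)
pairSeries-+ˡ P P′ Q f s = trans
  (∑-cong (range s) λ i → ∑-cong (range s) λ L₂ → ∑-cong (range s) λ L₃ →
     alg (f (+ L₂ - + L₃)) (P L₂ i) (P′ L₂ i) (Q L₃ (s ∸ i)))
  (∑³-+ (range s) (range s) (range s) (λ i L₂ L₃ → f (+ L₂ - + L₃) * (P L₂ i * Q L₃ (s ∸ i)))
                                      (λ i L₂ L₃ → f (+ L₂ - + L₃) * (P′ L₂ i * Q L₃ (s ∸ i))))
  where alg : ∀ x y z w → x * ((y + z) * w) ≡ x * (y * w) + x * (z * w)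
        alg = solve-∀

pairSeries-+ʳ : ∀ P Q Q′ f → pairSeries P (λ L i → Q L i + Q′ L i) f ≈ (pairSeries P Q f ⊕ pairSeries P Q′ f)
pairSeries-+ʳ P Q Q′ f s = trans
  (∑-cong (range s) λ i → ∑-cong (range s) λ L₂ → ∑-cong (range s) λ L₃ →
     alg (f (+ L₂ - + L₃)) (P L₂ i) (Q L₃ (s ∸ i)) (Q′ L₃ (s ∸ i)))
  (∑³-+ (range s) (range s) (range s) (λ i L₂ L₃ → f (+ L₂ - + L₃) * (P L₂ i * Q L₃ (s ∸ i)))
                                      (λ i L₂ L₃ → f (+ L₂ - + L₃) * (P L₂ i * Q′ L₃ (s ∸ i))))
  where alg : ∀ x y z w → x * (y * (z + w)) ≡ x * (y * z) + x * (y * w)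
        alg = solve-∀

-- X_{a,b}(f) of the header: L₂ and L₃ are the numbers of parts of π₂ and π₃.
crankSeries : ℕ → ℕ → (ℤ → ℤ) → Series
crankSeries a b = pairSeries (partitions a) (partitions b)

crankSeries-cong : ∀ a b {f f'} → (∀ m → f m ≡ f' m) → crankSeries a b f ≈ crankSeries a b f'
crankSeries-cong a b e s = ∑-cong (range s) λ i → ∑-cong (range s) λ L2 → ∑-cong (range s) λ L3 → cong (_* _) (e _)

pairSeries-withPartˡ : ∀ a b f → pairSeries (partitionsWithPart (suc a)) (partitions b) f ≈ shift (suc a) (crankSeries (suc a) b (λ m → f (m + 1ℤ)))
pairSeries-withPartˡ a b f s =
  begin
    pairSeries (partitionsWithPart c) (partitions b) f s
  ≡⟨ ∑-cong (range s) (λ i → trans (∑-upTo-suc s _) (trans (cong (λ z → z + ∑ (upTo s) (λ L → ∑ (range s) λ L3 → f (+ suc L - + L3) *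
      (partitionsWithPart c (suc L) i * partitions b L3 (s ∸ i)))) (∑-vanish (range s) (λ L3 → trans (cong (f (+ 0 - + L3) *_) (ℤP.*-zeroˡ
      (partitions b L3 (s ∸ i)))) (ℤP.*-zeroʳ (f (+ 0 - + L3)))))) (ℤP.+-identityˡ _))) ⟩
    ∑ (range s) (λ i → ∑ (upTo s) λ L → ∑ (range s) λ L3 → f (+ suc L - + L3) * (ind ⌊ c ℕ.≤? i ⌋ (partitions c L (i ∸ c)) * partitions b L3 (s ∸ i)))
  ≡⟨ ∑-cong (range s) (λ i → trans (∑-cong (upTo s) (λ L → trans (∑-cong (range s) (λ L3 → pull i L L3)) (∑-ind (range s) ⌊ c ℕ.≤? i ⌋ _))) (∑-ind
      (upTo s) ⌊ c ℕ.≤? i ⌋ _)) ⟩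
    ∑ (range s) (λ i → ind ⌊ c ℕ.≤? i ⌋ (∑ (upTo s) λ L → ∑ (range s) λ L3 → f (+ suc L - + L3) * (partitions c L (i ∸ c) * partitions b L3 (s ∸ i))))
  ≡⟨ ∑-cong (range s) (λ i → ind-case (c ℕ.≤? i) (λ le → ∑-cong (upTo s) λ L → ∑-cong (range s) λ L3 →
        cong (λ z → f (+ suc L - + L3) * (partitions c L (i ∸ c) * partitions b L3 z)) (∸-shift i le))) ⟩
    ∑ (range s) (λ i → ind ⌊ c ℕ.≤? i ⌋ (G (i ∸ c)))
  ≡⟨ ∑-upTo-shift c s G ⟩
    ind ⌊ c ℕ.≤? s ⌋ (∑ (range s') G)
  ≡⟨ ind-case (c ℕ.≤? s) (λ le → ∑-upTo-cong (suc s') (λ i' lt → inner le i' (ℕP.≤-pred lt))) ⟩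
    shift c (crankSeries c b (λ m → f (m + 1ℤ))) s
  ∎
  where
  open ≡-Reasoning
  c = suc a
  s' = s ∸ c
  G : ℕ → ℤ
  G i' = ∑ (upTo s) λ L → ∑ (range s) λ L3 → f (+ suc L - + L3) * (partitions c L i' * partitions b L3 (s' ∸ i'))
  pull : ∀ i L L3 → f (+ suc L - + L3) * (ind ⌊ c ℕ.≤? i ⌋ (partitions c L (i ∸ c)) * partitions b L3 (s ∸ i)) ≡ ind ⌊ c ℕ.≤? i ⌋ (f
      (+ suc L - + L3) * (partitions c L (i ∸ c) * partitions b L3 (s ∸ i)))
  pull i L L3 = trans (cong (f (+ suc L - + L3) *_) (ind-*ʳ ⌊ c ℕ.≤? i ⌋ (partitions c L (i ∸ c)) (partitions b L3 (s ∸ i)))) (ind-*ˡ ⌊ c ℕ.≤? i ⌋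
      (partitions c L (i ∸ c) * partitions b L3 (s ∸ i)) (f (+ suc L - + L3)))
  ∸-shift : ∀ i → c ≤ i → s ∸ i ≡ s' ∸ (i ∸ c)
  ∸-shift i le = trans (cong (s ∸_) (sym (ℕP.m+[n∸m]≡n le))) (sym (ℕP.∸-+-assoc s c (i ∸ c)))
  inner : c ≤ s → ∀ i' → i' ≤ s' → G i' ≡ ∑ (range s') (λ L → ∑ (range s') λ L3 → f (+ L - + L3 + 1ℤ) * (partitions c L i' * partitions b L3
      (s' ∸ i')))
  inner le i' i'le =
    trans (∑-upTo-extend (suc s') s s'<s (λ L ge → ∑-vanish (range s) (λ L3 → trans (cong (λ z → f (+ suc L - + L3) * (z * partitions b L3 (s' ∸ i')))
        (partitions-vanish c L i' (ℕP.<-≤-trans (s≤s i'le) ge))) (trans (cong (f (+ suc L - + L3) *_) (ℤP.*-zeroˡ (partitions b L3 (s' ∸ i'))))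
        (ℤP.*-zeroʳ (f (+ suc L - + L3)))))))
    (∑-cong (range s') λ L →
      trans (∑-upTo-extend (suc s') (suc s) (s≤s (ℕP.m∸n≤m s c)) (λ L3 ge → trans (cong (λ z → f (+ suc L - + L3) * (partitions c L i' * z))
          (partitions-vanish b L3 (s' ∸ i') (ℕP.<-≤-trans (s≤s (ℕP.m∸n≤m s' i')) ge))) (trans (cong (f (+ suc L - + L3) *_) (ℤP.*-zeroʳ
          (partitions c L i'))) (ℤP.*-zeroʳ (f (+ suc L - + L3))))))
            (∑-cong (range s') λ L3 → cong (λ z → f z * (partitions c L i' * partitions b L3 (s' ∸ i'))) (alg (+ L) (+ L3))))
    where
    s'<s : suc s' ≤ s
    s'<s = ℕP.≤-trans (ℕP.≤-reflexive (sym (ℕP.+-∸-assoc 1 le))) (ℕP.m∸n≤m s a)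
    alg : ∀ x y → 1ℤ + x - y ≡ x - y + 1ℤ
    alg = solve-∀

crankSeries-recˡ : ∀ a b f → crankSeries (suc a) b f ≈ (crankSeries a b f ⊕ shift (suc a) (crankSeries (suc a) b (λ m → f (m + 1ℤ))))
crankSeries-recˡ a b f s = begin
  crankSeries (suc a) b f s
    ≡⟨ pairSeries-congˡ (partitions b) f (partitions-suc a) s ⟩
  pairSeries (λ L i → partitions a L i + partitionsWithPart (suc a) L i) (partitions b) f s
    ≡⟨ pairSeries-+ˡ (partitions a) (partitionsWithPart (suc a)) (partitions b) f s ⟩
  crankSeries a b f s + pairSeries (partitionsWithPart (suc a)) (partitions b) f s
    ≡⟨ cong (_+_ (crankSeries a b f s)) (pairSeries-withPartˡ a b f s) ⟩
  crankSeries a b f s + shift (suc a) (crankSeries (suc a) b (λ m → f (m + 1ℤ))) s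
    ∎
  where open ≡-Reasoning

pairSeries-withPartʳ : ∀ a b f → pairSeries (partitions a) (partitionsWithPart (suc b)) f ≈ shift (suc b) (crankSeries a (suc b) (λ m → f (m - 1ℤ)))
pairSeries-withPartʳ a b f s =
  begin
    pairSeries (partitions a) (partitionsWithPart c) f s
  ≡⟨ ∑-cong (range s) (λ i → ∑-cong (range s) λ L2 → trans (∑-upTo-suc s _) (trans (cong (λ z → z + ∑ (upTo s) (λ L → f (+ L2 - + suc L) *
      (partitions a L2 i * partitionsWithPart c (suc L) (s ∸ i)))) (trans (cong (f (+ L2 - + 0) *_) (ℤP.*-zeroʳ (partitions a L2 i))) (ℤP.*-zeroʳ (f
      (+ L2 - + 0))))) (ℤP.+-identityˡ _))) ⟩
    ∑ (range s) (λ i → ∑ (range s) λ L2 → ∑ (upTo s) λ L → f (+ L2 - + suc L) * (partitions a L2 i * ind ⌊ c ℕ.≤? s ∸ i ⌋ (partitions c L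
        ((s ∸ i) ∸ c))))
  ≡⟨ ∑-cong (range s) (λ i → trans (∑-cong (range s) (λ L2 → trans (∑-cong (upTo s) (λ L → pull i L2 L)) (∑-ind (upTo s) ⌊ c ℕ.≤? s ∸ i ⌋ _))) (∑-ind
      (range s) ⌊ c ℕ.≤? s ∸ i ⌋ _)) ⟩
    ∑ (range s) (λ i → ind ⌊ c ℕ.≤? s ∸ i ⌋ (H i))
  ≡⟨ ∑-upTo-restrict c s H ⟩
    ind ⌊ c ℕ.≤? s ⌋ (∑ (range s') H)
  ≡⟨ ind-case (c ℕ.≤? s) (λ le → ∑-upTo-cong (suc s') (λ i lt → inner le i (ℕP.≤-pred lt))) ⟩
    shift c (crankSeries a c (λ m → f (m - 1ℤ))) s
  ∎
  where
  open ≡-Reasoning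
  c = suc b
  s' = s ∸ c
  H : ℕ → ℤ
  H i = ∑ (range s) λ L2 → ∑ (upTo s) λ L → f (+ L2 - + suc L) * (partitions a L2 i * partitions c L ((s ∸ i) ∸ c))
  pull : ∀ i L2 L → f (+ L2 - + suc L) * (partitions a L2 i * ind ⌊ c ℕ.≤? s ∸ i ⌋ (partitions c L ((s ∸ i) ∸ c))) ≡ ind ⌊ c ℕ.≤? s ∸ i ⌋ (f
      (+ L2 - + suc L) * (partitions a L2 i * partitions c L ((s ∸ i) ∸ c)))
  pull i L2 L = trans (cong (f (+ L2 - + suc L) *_) (ind-*ˡ ⌊ c ℕ.≤? s ∸ i ⌋ (partitions c L ((s ∸ i) ∸ c)) (partitions a L2 i)))
      (ind-*ˡ ⌊ c ℕ.≤? s ∸ i ⌋ (partitions a L2 i * partitions c L ((s ∸ i) ∸ c)) (f (+ L2 - + suc L)))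
  ∸-shift : ∀ i → (s ∸ i) ∸ c ≡ s' ∸ i
  ∸-shift i = trans (ℕP.∸-+-assoc s i c) (trans (cong (s ∸_) (ℕP.+-comm i c)) (sym (ℕP.∸-+-assoc s c i)))
  inner : c ≤ s → ∀ i → i ≤ s' → H i ≡ ∑ (range s') (λ L2 → ∑ (range s') λ L3 → f (+ L2 - + L3 - 1ℤ) * (partitions a L2 i * partitions c L3 (s' ∸ i)))
  inner le i ile =
    trans (∑-upTo-extend (suc s') (suc s) (s≤s (ℕP.m∸n≤m s c)) (λ L2 ge → ∑-vanish (upTo s) (λ L → trans (cong (λ z → f (+ L2 - + suc L) *
        (z * partitions c L ((s ∸ i) ∸ c))) (partitions-vanish a L2 i (ℕP.<-≤-trans (s≤s ile) ge))) (trans (cong (f (+ L2 - + suc L) *_) (ℤP.*-zeroˡ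
        (partitions c L ((s ∸ i) ∸ c)))) (ℤP.*-zeroʳ (f (+ L2 - + suc L)))))))
    (∑-cong (range s') λ L2 →
      trans (∑-upTo-extend (suc s') s s'<s (λ L ge → trans (cong (λ z → f (+ L2 - + suc L) * (partitions a L2 i * partitions c L z)) (∸-shift i)) (trans
          (cong (λ z → f (+ L2 - + suc L) * (partitions a L2 i * z)) (partitions-vanish c L (s' ∸ i) (ℕP.<-≤-trans (s≤s (ℕP.m∸n≤m s' i)) ge))) (trans
          (cong (f (+ L2 - + suc L) *_) (ℤP.*-zeroʳ (partitions a L2 i))) (ℤP.*-zeroʳ (f (+ L2 - + suc L)))))))
            (∑-cong (range s') λ L3 → cong₂ (λ z w → f z * (partitions a L2 i * partitions c L3 w)) (alg (+ L2) (+ L3)) (∸-shift i)))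
    where
    s'<s : suc s' ≤ s
    s'<s = ℕP.≤-trans (ℕP.≤-reflexive (sym (ℕP.+-∸-assoc 1 le))) (ℕP.m∸n≤m s b)
    alg : ∀ x y → x - (1ℤ + y) ≡ x - y - 1ℤ
    alg = solve-∀

crankSeries-recʳ : ∀ a b f → crankSeries a (suc b) f ≈ (crankSeries a b f ⊕ shift (suc b) (crankSeries a (suc b) (λ m → f (m - 1ℤ))))
crankSeries-recʳ a b f s = begin
  crankSeries a (suc b) f s
    ≡⟨ pairSeries-congʳ (partitions a) f (partitions-suc b) s ⟩
  pairSeries (partitions a) (λ L i → partitions b L i + partitionsWithPart (suc b) L i) f s
    ≡⟨ pairSeries-+ʳ (partitions a) (partitions b) (partitionsWithPart (suc b)) f s ⟩
  crankSeries a b f s + pairSeries (partitions a) (partitionsWithPart (suc b)) f s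
    ≡⟨ cong (_+_ (crankSeries a b f s)) (pairSeries-withPartʳ a b f s) ⟩
  crankSeries a b f s + shift (suc b) (crankSeries a (suc b) (λ m → f (m - 1ℤ))) s
    ∎
  where open ≡-Reasoning

-- (q;q)_b, expanded by Euler as a signed count of partitions into distinct parts at most b.
poch : ℕ → Series
poch b s = ∑ (range s) λ L → signPow L * strictPartitions b L s

poch-suc : ∀ n → poch (suc n) ≈ (poch n ⊕ negS (shift (suc n) (poch n)))
poch-suc n s =
  begin
    poch c s
  ≡⟨ ∑-upTo-suc s _ ⟩
    h0 + ∑ (upTo s) (λ L → signPow (suc L) * strictPartitions c (suc L) s)
  ≡⟨ cong (_+_ h0) (trans (∑-cong (upTo s) (λ L → ℤP.*-distribˡ-+ (signPow (suc L)) (strictPartitions n (suc L) s) _)) (∑-+ (upTo s) _ _)) ⟩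
    h0 + (A + B)
  ≡⟨ sym (ℤP.+-assoc h0 A B) ⟩
    (h0 + A) + B
  ≡⟨ cong₂ _+_ (sym (∑-upTo-suc s _)) Beq ⟩
    poch n s + - shift c (poch n) s
  ∎
  where
  open ≡-Reasoning
  c = suc n
  h0 = signPow 0 * strictPartitions n 0 s
  A = ∑ (upTo s) (λ L → signPow (suc L) * strictPartitions n (suc L) s)
  B = ∑ (upTo s) (λ L → signPow (suc L) * ind ⌊ c ℕ.≤? s ⌋ (strictPartitions n L (s ∸ c)))
  Beq : B ≡ - shift c (poch n) s
  Beq = trans (∑-cong (upTo s) (λ L → trans (sym (ℤP.neg-distribˡ-* (signPow L) (ind ⌊ c ℕ.≤? s ⌋ (strictPartitions n L (s ∸ c))))) (cong -_
      (ind-*ˡ ⌊ c ℕ.≤? s ⌋ (strictPartitions n L (s ∸ c)) (signPow L)))))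
        (trans (∑-neg (upTo s) _) (cong -_ (trans (∑-ind (upTo s) ⌊ c ℕ.≤? s ⌋ _)
           (ind-case (c ℕ.≤? s) (λ le → ∑-upTo-extend (suc (s ∸ c)) s (ℕP.≤-trans (ℕP.≤-reflexive (sym (ℕP.+-∸-assoc 1 le))) (ℕP.m∸n≤m s n))
               (λ L ge → trans (cong (signPow L *_) (strictPartitions-vanish n L (s ∸ c) ge)) (ℤP.*-zeroʳ (signPow L))))))))

poch-zero : poch 0 ≈ oneS
poch-zero s = trans (∑-upTo-suc s _) (trans (cong (λ z → 1ℤ * strictPartitions 0 0 s + z) (∑-vanish (upTo s) (λ L → ℤP.*-zeroʳ (signPow (suc L)))))
  (trans (ℤP.+-identityʳ _) (trans (ℤP.*-identityˡ _) (lem s))))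
  where
  lem : ∀ s → ind ⌊ s ℕ.≟ 0 ⌋ 1ℤ ≡ oneS s
  lem zero = refl
  lem (suc s) = refl

crankSeries-empty : ∀ f → crankSeries 0 0 f ≈ constS (f 0ℤ)
crankSeries-empty f s =
  begin
    crankSeries 0 0 f s
  ≡⟨ ∑-cong (range s) (λ i → trans (∑-upTo-head s (λ L2 → ∑ (range s) λ L3 → f (+ L2 - + L3) * (partitions 0 L2 i * partitions 0 L3 (s ∸ i)))
          (λ L2 → ∑-vanish (range s) (λ L3 → trans (cong (λ z → f (+ suc L2 - + L3) * z) (ℤP.*-zeroˡ (partitions 0 L3 (s ∸ i)))) (ℤP.*-zeroʳ (f
              (+ suc L2 - + L3))))))
          (∑-upTo-head s (λ L3 → f (+ 0 - + L3) * (partitions 0 0 i * partitions 0 L3 (s ∸ i)))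
          (λ L3 → trans (cong (λ z → f (+ 0 - + suc L3) * z) (ℤP.*-zeroʳ (partitions 0 0 i))) (ℤP.*-zeroʳ (f (+ 0 - + suc L3)))))) ⟩
    ∑ (range s) (λ i → f 0ℤ * (ind ⌊ i ℕ.≟ 0 ⌋ 1ℤ * ind ⌊ s ∸ i ℕ.≟ 0 ⌋ 1ℤ))
  ≡⟨ ∑-cong (range s) (λ i → trans (cong (f 0ℤ *_) (ind-*ʳ ⌊ i ℕ.≟ 0 ⌋ 1ℤ (ind ⌊ s ∸ i ℕ.≟ 0 ⌋ 1ℤ))) (ind-*ˡ ⌊ i ℕ.≟ 0 ⌋ _ (f 0ℤ))) ⟩
    ∑ (range s) (λ i → ind ⌊ i ℕ.≟ 0 ⌋ (f 0ℤ * (1ℤ * ind ⌊ s ∸ i ℕ.≟ 0 ⌋ 1ℤ)))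
  ≡⟨ ∑-upTo-select-< (suc s) 0 (λ i → f 0ℤ * (1ℤ * ind ⌊ s ∸ i ℕ.≟ 0 ⌋ 1ℤ)) (s≤s z≤n) ⟩
    f 0ℤ * (1ℤ * ind ⌊ s ℕ.≟ 0 ⌋ 1ℤ)
  ≡⟨ lem s ⟩
    constS (f 0ℤ) s
  ∎
  where
  open ≡-Reasoning
  lem : ∀ s → f 0ℤ * (1ℤ * ind ⌊ s ℕ.≟ 0 ⌋ 1ℤ) ≡ constS (f 0ℤ) s
  lem zero = trans (cong (f 0ℤ *_) refl) (ℤP.*-identityʳ (f 0ℤ))
  lem (suc s) = ℤP.*-zeroʳ (f 0ℤ)

crankSeries-+ : ∀ a b f h → crankSeries a b (λ m → f m + h m) ≈ (crankSeries a b f ⊕ crankSeries a b h)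
crankSeries-+ a b f h s = trans (∑-cong (range s) (λ i → ∑-cong (range s) λ L2 → ∑-cong (range s) λ L3 → ℤP.*-distribʳ-+
    (partitions a L2 i * partitions b L3 (s ∸ i)) (f (+ L2 - + L3)) (h (+ L2 - + L3))))
   (∑³-+ (range s) (range s) (range s) (λ i L2 L3 → f (+ L2 - + L3) * (partitions a L2 i * partitions b L3 (s ∸ i))) (λ i L2 L3 → h (+ L2 - + L3) *
       (partitions a L2 i * partitions b L3 (s ∸ i))))

crankSeries-neg : ∀ a b f → crankSeries a b (λ m → - f m) ≈ negS (crankSeries a b f)
crankSeries-neg a b f s = trans (∑-cong (range s) (λ i → ∑-cong (range s) λ L2 → ∑-cong (range s) λ L3 → sym (ℤP.neg-distribˡ-* (f (+ L2 - + L3))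
    (partitions a L2 i * partitions b L3 (s ∸ i)))))
   (trans (∑-cong (range s) (λ i → trans (∑-cong (range s) (λ L2 → ∑-neg (range s) _)) (∑-neg (range s) _))) (∑-neg (range s) _))

crankSeries-zeroWeight : ∀ a b → crankSeries a b (λ _ → 0ℤ) ≈ zeroS
crankSeries-zeroWeight a b s = ∑-vanish (range s) (λ i → ∑-vanish (range s) λ L2 → ∑-vanish (range s) λ L3 → ℤP.*-zeroˡ
    (partitions a L2 i * partitions b L3 (s ∸ i)))

𝟙 : Series
𝟙 = constS 1ℤ

≈⊕shift⇒≋ : ∀ {f g h} c → f ≈ (g ⊕ shift c h) → f ≋ (g +ₛ monomial c *ₛ h)
≈⊕shift⇒≋ {f} {g} {h} c e = ≋i (λ n → trans (e n) (sym (trans (+ₛ-def g (monomial c *ₛ h) n) (cong (_+_ (g n)) (trans (*ₛ-def (monomial c) h n) (sym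
    (shift≈monomial⊛ c h n)))))))

poch-factor : ∀ n → poch (suc n) ≋ poch n -ₛ monomial (suc n) *ₛ poch n
poch-factor n = ≋i λ s → begin
  poch (suc n) s                               ≡⟨ poch-suc n s ⟩
  poch n s + - shift (suc n) (poch n) s        ≡⟨ cong (λ z → poch n s + - z) (shift≈monomial⊛ (suc n) (poch n) s) ⟩
  poch n s + - (monomial (suc n) ⊛ poch n) s   ≡⟨ cong (λ z → poch n s + - z) (*ₛ-def (monomial (suc n)) (poch n) s) ⟨
  poch n s + - (monomial (suc n) *ₛ poch n) s  ≡⟨ cong (_+_ (poch n s)) (-ₛ-def (monomial (suc n) *ₛ poch n) s) ⟨
  poch n s + (-ₛ (monomial (suc n) *ₛ poch n)) s ≡⟨ +ₛ-def (poch n) (-ₛ (monomial (suc n) *ₛ poch n)) s ⟨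
  (poch n -ₛ monomial (suc n) *ₛ poch n) s     ∎
  where open ≡-Reasoning

-- The solver cannot use hypotheses, so it first writes the left-hand side as the right-hand side plus
-- multiples of the differences of the two sides of h1–h4; substituting h1–h4 makes them cancel.
crankSeries-rec : ∀ n f → let N = suc n ; u = monomial N in
  (𝟙 -ₛ u) *ₛ ((𝟙 -ₛ u) *ₛ crankSeries N N f) ≋ crankSeries n n f +ₛ u *ₛ crankSeries N N (Δ² f)
crankSeries-rec n f = begin
    (𝟙 -ₛ u) *ₛ ((𝟙 -ₛ u) *ₛ A)
  ≈⟨ solve 8 (λ u A B C D Eb G H → ((con 1ℤ :- u) :* ((con 1ℤ :- u) :* A)) :=
        ((D :+ (u :* H)) :+ (((A :- (B :+ u :* C)) :+ (B :- (D :+ u :* Eb))) :- (u :* (G :- (Eb :+ u :* A))) :- (u :* (H :- ((C :+ G) :-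
            (A :+ A))))))) (≋i (λ n → refl)) u A B C D Eb G H ⟩
    (D +ₛ u *ₛ H) +ₛ ((A -ₛ (B +ₛ u *ₛ C)) +ₛ (B -ₛ (D +ₛ u *ₛ Eb)) -ₛ u *ₛ (G -ₛ (Eb +ₛ u *ₛ A)) -ₛ u *ₛ (H -ₛ (C +ₛ G -ₛ (A +ₛ A))))
  ≈⟨ +-cong ≋-refl (+-cong (+-cong (+-cong (+-cong h1 ≋-refl) (+-cong h2 ≋-refl)) (-‿cong (*-cong ≋-refl (+-cong h3 ≋-refl)))) (-‿cong (*-cong ≋-refl
      (+-cong h4 ≋-refl)))) ⟩
    (D +ₛ u *ₛ H) +ₛ (((B +ₛ u *ₛ C) -ₛ (B +ₛ u *ₛ C)) +ₛ ((D +ₛ u *ₛ Eb) -ₛ (D +ₛ u *ₛ Eb)) -ₛ u *ₛ ((Eb +ₛ u *ₛ A) -ₛ (Eb +ₛ u *ₛ A)) -ₛ u *ₛ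
        ((C +ₛ G -ₛ (A +ₛ A)) -ₛ (C +ₛ G -ₛ (A +ₛ A))))
  ≈⟨ solve 8 (λ u A B C D Eb G H → (D :+ u :* H) :+ (((B :+ u :* C) :- (B :+ u :* C)) :+ ((D :+ u :* Eb) :- (D :+ u :* Eb)) :- u :* ((Eb :+ u :* A) :-
      (Eb :+ u :* A)) :- u :* ((C :+ G :- (A :+ A)) :- (C :+ G :- (A :+ A))))
        := D :+ u :* H) (≋i (λ n → refl)) u A B C D Eb G H ⟩
    D +ₛ u *ₛ H
  ∎
  where
  open ≋-Reasoning
  N = suc n
  u = monomial N
  Ef : ℤ → ℤ
  Ef m = f (m + 1ℤ)
  E⁻f : ℤ → ℤ
  E⁻f m = f (m - 1ℤ)
  A = crankSeries N N f
  B = crankSeries n N f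
  C = crankSeries N N Ef
  D = crankSeries n n f
  Eb = crankSeries n N E⁻f
  G = crankSeries N N E⁻f
  H = crankSeries N N (Δ² f)
  h1 : A ≋ B +ₛ u *ₛ C
  h1 = ≈⊕shift⇒≋ N (crankSeries-recˡ n N f)
  h2 : B ≋ D +ₛ u *ₛ Eb
  h2 = ≈⊕shift⇒≋ N (crankSeries-recʳ n n f)
  h3 : G ≋ Eb +ₛ u *ₛ A
  h3 = ≈⊕shift⇒≋ {G} {Eb} {A} N (≈-trans (crankSeries-recˡ n N E⁻f) (⊕-cong {Eb} {Eb} (λ s → refl) (λ s → cong (ind ⌊ N ℕ.≤? s ⌋)
      (crankSeries-cong N N {λ m → f (m + 1ℤ - 1ℤ)} {f} (λ m → cong f (alg m)) (s ∸ N)))))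
    where alg : ∀ m → m + 1ℤ - 1ℤ ≡ m
          alg = solve-∀
  h4 : H ≋ C +ₛ G -ₛ (A +ₛ A)
  h4 = ≋i (λ s → trans (crankSeries-+ N N (λ m → Ef m + E⁻f m) (λ m → - (f m + f m)) s)
         (trans (cong₂ _+_ (crankSeries-+ N N Ef E⁻f s) (trans (crankSeries-neg N N (λ m → f m + f m) s) (cong -_ (crankSeries-+ N N f f s))))
         (sym (trans (+ₛ-def (C +ₛ G) (-ₛ (A +ₛ A)) s) (cong₂ _+_ (+ₛ-def C G s) (trans (-ₛ-def (A +ₛ A) s) (cong -_ (+ₛ-def A A s))))))))

invOneMinus-inverse : ∀ N → 1 ≤ N → invOneMinus N *ₛ (𝟙 -ₛ monomial N) ≋ 𝟙
invOneMinus-inverse N N≥1 = ≋i λ n →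
  trans (*ₛ-def v (𝟙 -ₛ u) n) (trans (⊛-comm v (𝟙 -ₛ u) n) (trans (⊛-congˡ v (λ k → trans (+ₛ-def 𝟙 (-ₛ u) k) (cong (_+_ (𝟙 k)) (-ₛ-def u k))) n)
  (trans (⊛-distribʳ v 𝟙 (negS u) n) (trans (cong₂ _+_ (trans (constS-⊛ 1ℤ v n) (ℤP.*-identityˡ (v n))) (trans (negS-⊛ u v n) (cong -_ (sym
      (shift≈monomial⊛ N v n)))))
  (fin n)))))
  where
  u = monomial N
  v = invOneMinus N
  fin : ∀ n → v n + - shift N v n ≡ 𝟙 n
  fin n with N ℕ.≤? n
  ... | yes le = trans (cong (λ z → z + - v (n ∸ N)) (same le)) (trans (ℤP.+-inverseʳ (v (n ∸ N))) (sym (one0 n (ℕP.≤-trans N≥1 le))))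
    where
    same : N ≤ n → v n ≡ v (n ∸ N)
    same le = ind-iff (N ∣? n) (N ∣? (n ∸ N)) (λ d → Div.∣m+n∣m⇒∣n (subst (N ∣_) (sym (ℕP.m+[n∸m]≡n le)) d) Div.∣-refl)
                      (λ d → Div.∣m∸n∣n⇒∣m N le d Div.∣-refl) 1ℤ
    one0 : ∀ n → 1 ≤ n → 𝟙 n ≡ 0ℤ
    one0 (suc n) _ = refl
  ... | no nle = trans (ℤP.+-identityʳ (v n)) (lt n (ℕP.≰⇒> nle))
    where
    lt : ∀ n → n < N → v n ≡ 𝟙 n
    lt zero _ = ind-yes (N ∣? 0) (Div._∣0 N) 1ℤ
    lt (suc n) l = ind-no (N ∣? suc n) (λ d → ℕP.<-irrefl refl (ℕP.<-≤-trans l (Div.∣⇒≤ d))) 1ℤ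

reduced : ℕ → (ℤ → ℤ) → Series
reduced b f = poch b *ₛ (poch b *ₛ crankSeries b b f)

reduced-rec : ∀ n f → reduced (suc n) f ≋ reduced n f +ₛ chainTerm (suc n) *ₛ reduced (suc n) (Δ² f)
reduced-rec n f = begin
    EN *ₛ (EN *ₛ A)
  ≈⟨ solve 7 (λ EN En u v A D H → EN :* (EN :* A) :=
        (En :* (En :* D) :+ (u :* (v :* v)) :* (EN :* (EN :* H)))
        :+ ((EN :+ En :* (con 1ℤ :- u)) :* (A :- u :* v :* v :* H)) :* (EN :- (En :- u :* En))
        :+ (En :* En) :* (((con 1ℤ :- u) :* ((con 1ℤ :- u) :* A)) :- (D :+ u :* H))
        :- ((En :* En :* u :* H) :* (v :* (con 1ℤ :- u) :+ con 1ℤ)) :* ((v :* (con 1ℤ :- u)) :- con 1ℤ))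
        (≋i (λ n → refl)) EN En u v A D H ⟩
    (En *ₛ (En *ₛ D) +ₛ (u *ₛ (v *ₛ v)) *ₛ (EN *ₛ (EN *ₛ H)))
        +ₛ ((EN +ₛ En *ₛ (𝟙 -ₛ u)) *ₛ (A -ₛ u *ₛ v *ₛ v *ₛ H)) *ₛ (EN -ₛ (En -ₛ u *ₛ En))
        +ₛ (En *ₛ En) *ₛ (((𝟙 -ₛ u) *ₛ ((𝟙 -ₛ u) *ₛ A)) -ₛ (D +ₛ u *ₛ H))
        -ₛ ((En *ₛ En *ₛ u *ₛ H) *ₛ (v *ₛ (𝟙 -ₛ u) +ₛ 𝟙)) *ₛ ((v *ₛ (𝟙 -ₛ u)) -ₛ 𝟙)
  ≈⟨ +-cong (+-cong (+-cong (+-cong ≋-refl (*-cong (≋-sym hT) ≋-refl)) (*-cong ≋-refl (+-cong (poch-factor n) ≋-refl))) (*-cong ≋-refl (+-cong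
      (crankSeries-rec n f) ≋-refl))) (-‿cong (*-cong ≋-refl (+-cong (invOneMinus-inverse N (s≤s z≤n)) ≋-refl))) ⟩
    (En *ₛ (En *ₛ D) +ₛ chainTerm N *ₛ (EN *ₛ (EN *ₛ H)))
        +ₛ ((EN +ₛ En *ₛ (𝟙 -ₛ u)) *ₛ (A -ₛ u *ₛ v *ₛ v *ₛ H)) *ₛ ((En -ₛ u *ₛ En) -ₛ (En -ₛ u *ₛ En))
        +ₛ (En *ₛ En) *ₛ ((D +ₛ u *ₛ H) -ₛ (D +ₛ u *ₛ H))
        -ₛ ((En *ₛ En *ₛ u *ₛ H) *ₛ (v *ₛ (𝟙 -ₛ u) +ₛ 𝟙)) *ₛ (𝟙 -ₛ 𝟙)
  ≈⟨ solve 8 (λ EN En u v A D H T →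
        (En :* (En :* D) :+ T :* (EN :* (EN :* H)))
        :+ ((EN :+ En :* (con 1ℤ :- u)) :* (A :- u :* v :* v :* H)) :* ((En :- u :* En) :- (En :- u :* En))
        :+ (En :* En) :* ((D :+ u :* H) :- (D :+ u :* H))
        :- ((En :* En :* u :* H) :* (v :* (con 1ℤ :- u) :+ con 1ℤ)) :* (con 1ℤ :- con 1ℤ)
        := En :* (En :* D) :+ T :* (EN :* (EN :* H)))
        (≋i (λ n → refl)) EN En u v A D H (chainTerm N) ⟩
    En *ₛ (En *ₛ D) +ₛ chainTerm N *ₛ (EN *ₛ (EN *ₛ H))
  ∎
  where
  open ≋-Reasoning
  N = suc n
  u = monomial N
  v = invOneMinus N
  EN = poch N
  En = poch n
  A = crankSeries N N f
  D = crankSeries n n f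
  H = crankSeries N N (Δ² f)
  hT : chainTerm N ≋ u *ₛ (v *ₛ v)
  hT = ≋i (λ s → sym (trans (*ₛ-def u (v *ₛ v) s) (⊛-congʳ u (*ₛ-def v v) s)))

reduced-def : ∀ b f → reduced b f ≈ (poch b ⊛ (poch b ⊛ crankSeries b b f))
reduced-def b f n = trans (*ₛ-def (poch b) (poch b *ₛ crankSeries b b f) n) (⊛-congʳ (poch b) (*ₛ-def (poch b) (crankSeries b b f)) n)

reduced-cong : ∀ b {f f'} → (∀ m → f m ≡ f' m) → reduced b f ≋ reduced b f'
reduced-cong b e = *-cong ≋-refl (*-cong ≋-refl (≋i (crankSeries-cong b b e)))

reduced-zeroWeight : ∀ b → reduced b (λ _ → 0ℤ) ≋ zeroS
reduced-zeroWeight b = ≋i (≈-trans (reduced-def b (λ _ → 0ℤ))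
  (≈-trans (⊛-congʳ (poch b) (⊛-congʳ (poch b) (crankSeries-zeroWeight b b)))
  (≈-trans (⊛-congʳ (poch b) (⊛-zeroʳ (poch b))) (⊛-zeroʳ (poch b)))))

reduced-empty : ∀ f → reduced 0 f ≈ constS (f 0ℤ)
reduced-empty f = ≈-trans (reduced-def 0 f) (≈-trans (⊛-cong poch-zero (⊛-cong poch-zero (crankSeries-empty f))) (≈-trans (⊛-oneˡ _) (⊛-oneˡ _)))

headLe : ℕ → List ℕ → Bool
headLe b [] = true
headLe b (y ∷ _) = ⌊ y ℕ.≤? b ⌋

headLt : ℕ → List ℕ → Bool
headLt b [] = true
headLt b (y ∷ _) = ⌊ y ℕ.<? b ⌋

nonIncreasing-∷ : ∀ x ys → nonIncreasing (x ∷ ys) ≡ headLe x ys ∧ nonIncreasing ys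
nonIncreasing-∷ x [] = refl
nonIncreasing-∷ x (y ∷ ys) = refl

decreasing-∷ : ∀ x ys → decreasing (x ∷ ys) ≡ headLt x ys ∧ decreasing ys
decreasing-∷ x [] = refl
decreasing-∷ x (y ∷ ys) = refl

headLt-suc : ∀ i ys z → ind (headLt (suc i) ys) z ≡ ind (headLe i ys) z
headLt-suc i [] z = refl
headLt-suc i (y ∷ ys) z = ind-iff (y ℕ.<? suc i) (y ℕ.≤? i) ℕP.≤-pred s≤s z

ind-+-≟ : ∀ x σ s → ind ⌊ x ℕ.+ σ ℕ.≟ s ⌋ 1ℤ ≡ ind ⌊ x ℕ.≤? s ⌋ (ind ⌊ σ ℕ.≟ s ∸ x ⌋ 1ℤ)
ind-+-≟ x σ s with x ℕ.≤? s
... | yes le = ind-iff (x ℕ.+ σ ℕ.≟ s) (σ ℕ.≟ s ∸ x) (λ e → trans (sym (ℕP.m+n∸m≡n x σ)) (cong (_∸ x) e)) (λ e → trans (cong (x ℕ.+_) e)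
    (ℕP.m+[n∸m]≡n le)) 1ℤ
... | no nle = ind-no (x ℕ.+ σ ℕ.≟ s) (λ e → nle (ℕP.≤-trans (ℕP.m≤m+n x σ) (ℕP.≤-reflexive e))) 1ℤ

headGe : ℕ → List ℕ → Bool
headGe a [] = true
headGe a (x ∷ _) = ⌊ a ℕ.≤? x ⌋

nonDecreasing-∷ : ∀ x ys → nonDecreasing (x ∷ ys) ≡ headGe x ys ∧ nonDecreasing ys
nonDecreasing-∷ x [] = refl
nonDecreasing-∷ x (y ∷ ys) = refl

module Lists (N : ℕ) where

  parts : List ℕ
  parts = oneTo N

  lists : ℕ → List (List ℕ)
  lists L = listsOfLength N L

  ∑-lists-suc : ∀ k (F : List ℕ → ℤ) → ∑ (lists (suc k)) F ≡ ∑ parts (λ x → ∑ (lists k) (λ ys → F (x ∷ ys)))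
  ∑-lists-suc k F = trans (∑-concatMap (λ x → map (x ∷_) (lists k)) parts F) (∑-cong parts (λ x → ∑-map (x ∷_) (lists k) F))

  ∑-parts-cong : ∀ (F : ℕ → ℤ) {G : ℕ → ℤ} → (∀ x → 1 ≤ x → x ≤ N → F x ≡ G x) → ∑ parts F ≡ ∑ parts G
  ∑-parts-cong F {G} e = trans (∑-oneTo N F) (trans (∑-upTo-cong N (λ i lt → e (suc i) (s≤s z≤n) lt)) (sym (∑-oneTo N G)))

  ∑-lists-length-cong : ∀ L {F G : List ℕ → ℤ} → (∀ w → length w ≡ L → F w ≡ G w) → ∑ (lists L) F ≡ ∑ (lists L) G
  ∑-lists-length-cong zero {F} {G} e = trans (∑-singleton [] F) (trans (e [] refl) (sym (∑-singleton [] G)))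
  ∑-lists-length-cong (suc L) {F} {G} e = trans (∑-lists-suc L F) (trans (∑-cong parts (λ x → ∑-lists-length-cong L (λ ys l → e (x ∷ ys)
      (cong suc l)))) (sym (∑-lists-suc L G)))

  boundedSum : ℕ → (ℕ → ℤ) → ℤ
  boundedSum b F = ∑ parts (λ x → ind ⌊ x ℕ.≤? b ⌋ (F x))

  boundedSum-0 : ∀ F → boundedSum 0 F ≡ 0ℤ
  boundedSum-0 F = trans (∑-oneTo N _) (∑-zero (upTo N))

  boundedSum-suc : ∀ b F → suc b ≤ N → boundedSum (suc b) F ≡ boundedSum b F + F (suc b)
  boundedSum-suc b F le = trans (∑-oneTo N _) (trans (∑-cong (upTo N) (λ i → split i (F (suc i))))
     (trans (∑-+ (upTo N) _ _) (cong₂ _+_ (sym (∑-oneTo N _)) (∑-upTo-select-< N b (λ i → F (suc i)) le))))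
    where
    split : ∀ i x → ind ⌊ suc i ℕ.≤? suc b ⌋ x ≡ ind ⌊ suc i ℕ.≤? b ⌋ x + ind ⌊ i ℕ.≟ b ⌋ x
    split i x with suc i ℕ.≤? suc b | suc i ℕ.≤? b | i ℕ.≟ b
    ... | yes p | yes q | yes refl = ⊥-elim (ℕP.<-irrefl refl q)
    ... | yes p | yes q | no _ = sym (ℤP.+-identityʳ x)
    ... | yes p | no q | yes r = sym (ℤP.+-identityˡ x)
    ... | yes p | no q | no r = ⊥-elim (r (ℕP.≤-antisym (ℕP.≤-pred p) (ℕP.≮⇒≥ q)))
    ... | no p | _ | yes refl = ⊥-elim (p ℕP.≤-refl)
    ... | no p | yes q | _ = ⊥-elim (p (ℕP.m≤n⇒m≤1+n q))
    ... | no p | no q | no r = refl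

module Chains (N₀ : ℕ) where
  open Lists N₀

  -- Both sum Π q^{n_i}/(1 − q^{n_i})² over chains a ≤ n_1 ≤ ⋯ ≤ n_k ≤ b of parts: chainsFromBottom
  -- peels off the smallest element, like the enumeration in chainSum, chainsFromTop the largest,
  -- like the recursion of reduced.
  chainsFromBottom : ℕ → ℕ → ℕ → Series
  chainsFromBottom a b zero = oneS
  chainsFromBottom a b (suc k) n = ∑ parts (λ x → ind (⌊ a ℕ.≤? x ⌋ ∧ ⌊ x ℕ.≤? b ⌋) ((chainTerm x ⊛ chainsFromBottom x b k) n))

  chainsFromTop : ℕ → ℕ → ℕ → Series
  chainsFromTop a b zero = oneS
  chainsFromTop a b (suc k) n = ∑ parts (λ y → ind (⌊ a ℕ.≤? y ⌋ ∧ ⌊ y ℕ.≤? b ⌋) ((chainTerm y ⊛ chainsFromTop a y k) n))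

  chainTerm-⊛-comm : ∀ x y M → (chainTerm x ⊛ (chainTerm y ⊛ M)) ≈ (chainTerm y ⊛ (chainTerm x ⊛ M))
  chainTerm-⊛-comm x y M = ≈-trans (≈-sym (⊛-assoc (chainTerm x) (chainTerm y) M))
                  (≈-trans (⊛-congˡ M (⊛-comm (chainTerm x) (chainTerm y))) (⊛-assoc (chainTerm y) (chainTerm x) M))

  chainsFromBottom≈chainsFromTop : ∀ k a b → chainsFromBottom a b k ≈ chainsFromTop a b k
  chainsFromBottom≈chainsFromTop zero a b n = refl
  chainsFromBottom≈chainsFromTop (suc zero) a b n = refl
  chainsFromBottom≈chainsFromTop (suc (suc k)) a b n =
    begin
      ∑ parts (λ x → ind (between a x b) ((chainTerm x ⊛ chainsFromBottom x b (suc k)) n))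
    ≡⟨ ∑-cong parts (λ x → cong (ind (between a x b)) (⊛-congʳ (chainTerm x) (chainsFromBottom≈chainsFromTop (suc k) x b) n)) ⟩
      ∑ parts (λ x → ind (between a x b) ((chainTerm x ⊛ chainsFromTop x b (suc k)) n))
    ≡⟨ ∑-cong parts (λ x → trans (cong (ind (between a x b)) (⊛-∑-ind (chainTerm x) parts (λ y → between x y b) (λ y → chainTerm y ⊛ chainsFromTop x y k) n))
        (sym (∑-ind parts (between a x b) _))) ⟩
      ∑ parts (λ x → ∑ parts (λ y → ind (between a x b) (ind (between x y b) ((chainTerm x ⊛ (chainTerm y ⊛ chainsFromTop x y k)) n))))
    ≡⟨ ∑-swap parts parts _ ⟩
      ∑ parts (λ y → ∑ parts (λ x → ind (between a x b) (ind (between x y b) ((chainTerm x ⊛ (chainTerm y ⊛ chainsFromTop x y k)) n))))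
    ≡⟨ ∑-cong parts (λ y → ∑-cong parts (λ x → trans (between-trans a x y b _) (cong (ind (between a y b)) (cong (ind (between a x y))
          (trans (chainTerm-⊛-comm x y (chainsFromTop x y k) n) (⊛-congʳ (chainTerm y) (⊛-congʳ (chainTerm x) (≈-sym
              (chainsFromBottom≈chainsFromTop k x y))) n)))))) ⟩
      ∑ parts (λ y → ∑ parts (λ x → ind (between a y b) (ind (between a x y) ((chainTerm y ⊛ (chainTerm x ⊛ chainsFromBottom x y k)) n))))
    ≡⟨ ∑-cong parts (λ y → trans (∑-ind parts (between a y b) _) (cong (ind (between a y b)) (sym (⊛-∑-ind (chainTerm y) parts (λ x → between a x y)
        (λ x → chainTerm x ⊛ chainsFromBottom x y k) n)))) ⟩
      ∑ parts (λ y → ind (between a y b) ((chainTerm y ⊛ chainsFromBottom a y (suc k)) n))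
    ≡⟨ ∑-cong parts (λ y → cong (ind (between a y b)) (⊛-congʳ (chainTerm y) (chainsFromBottom≈chainsFromTop (suc k) a y) n)) ⟩
      ∑ parts (λ y → ind (between a y b) ((chainTerm y ⊛ chainsFromTop a y (suc k)) n))
    ∎
    where
    open ≡-Reasoning
    between : ℕ → ℕ → ℕ → Bool
    between a x b = ⌊ a ℕ.≤? x ⌋ ∧ ⌊ x ℕ.≤? b ⌋
    between-trans : ∀ a x y b z → ind (between a x b) (ind (between x y b) z) ≡ ind (between a y b) (ind (between a x y) z)
    between-trans a x y b z = trans (cong (ind (between a x b)) (ind-dec-∧ (x ℕ.≤? y) (y ℕ.≤? b) z)) (trans (ind-dec-∧ (a ℕ.≤? x) (x ℕ.≤? b) _)
       (trans (ind²-iff ((a ℕ.≤? x) ×-dec (x ℕ.≤? b)) ((x ℕ.≤? y) ×-dec (y ℕ.≤? b)) ((a ℕ.≤? y) ×-dec (y ℕ.≤? b)) ((a ℕ.≤? x) ×-dec (x ℕ.≤? y))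
          (λ { ((ax , xb) , (xy , yb)) → (ℕP.≤-trans ax xy , yb) , (ax , xy) })
          (λ { ((ay , yb) , (ax , xy)) → (ax , ℕP.≤-trans xy yb) , (xy , yb) }) z)
       (sym (trans (cong (ind (between a y b)) (ind-dec-∧ (a ℕ.≤? x) (x ℕ.≤? y) z)) (ind-dec-∧ (a ℕ.≤? y) (y ℕ.≤? b) _)))))

  chainSeries : ℕ → ℕ → Series
  chainSeries b k = chainsFromTop 1 b k

  chainSeries-boundedSum : ∀ b k n → chainSeries b (suc k) n ≡ boundedSum b (λ y → (chainTerm y ⊛ chainSeries y k) n)
  chainSeries-boundedSum b k n = ∑-parts-cong _ λ y 1≤y _ →
    trans (ind-∧ ⌊ 1 ℕ.≤? y ⌋ ⌊ y ℕ.≤? b ⌋ _) (ind-yes (1 ℕ.≤? y) 1≤y _)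

  chainSeries-0 : ∀ k → chainSeries 0 (suc k) ≈ zeroS
  chainSeries-0 k n = trans (chainSeries-boundedSum 0 k n) (boundedSum-0 _)

  chainSeries-suc : ∀ n k → suc n ≤ N₀ → chainSeries (suc n) (suc k) ≈ (chainSeries n (suc k) ⊕ (chainTerm (suc n) ⊛ chainSeries (suc n) k))
  chainSeries-suc n k le m = trans (chainSeries-boundedSum (suc n) k m)
    (trans (boundedSum-suc n _ le) (cong (_+ (chainTerm (suc n) ⊛ chainSeries (suc n) k) m) (sym (chainSeries-boundedSum n k m))))

  chainProduct : List ℕ → Series
  chainProduct c = prodS (map chainTerm c)

  listChains : ℕ → ℕ → Series
  listChains a k n = ∑ (lists k) (λ c → ind (headGe a c ∧ nonDecreasing c) (chainProduct c n))

  ∑-lists-chain-∷ : ∀ x k n → ∑ (lists k) (λ ys → ind (nonDecreasing (x ∷ ys)) (chainProduct (x ∷ ys) n)) ≡ (chainTerm x ⊛ listChains x k) n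
  ∑-lists-chain-∷ x k n = trans (∑-cong (lists k) (λ ys → cong (λ b → ind b (chainProduct (x ∷ ys) n)) (nonDecreasing-∷ x ys)))
                      (sym (⊛-∑-ind (chainTerm x) (lists k) (λ ys → headGe x ys ∧ nonDecreasing ys) chainProduct n))

  listChains≈chainsFromBottom : ∀ k a → listChains a k ≈ chainsFromBottom a N₀ k
  listChains≈chainsFromBottom zero a n = ∑-singleton [] _
  listChains≈chainsFromBottom (suc k) a n = trans (∑-lists-suc k _) (∑-parts-cong _ (λ x _ xle →
     trans (∑-cong (lists k) (λ ys → ind-∧ ⌊ a ℕ.≤? x ⌋ (nonDecreasing (x ∷ ys)) (chainProduct (x ∷ ys) n)))
     (trans (∑-ind (lists k) ⌊ a ℕ.≤? x ⌋ _) (trans (cong (ind ⌊ a ℕ.≤? x ⌋) (trans (∑-lists-chain-∷ x k n) (⊛-congʳ (chainTerm x)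
         (listChains≈chainsFromBottom k x) n)))
     (trans (cong (ind ⌊ a ℕ.≤? x ⌋) (sym (ind-yes (x ℕ.≤? N₀) xle _))) (sym (ind-∧ ⌊ a ℕ.≤? x ⌋ ⌊ x ℕ.≤? N₀ ⌋ _)))))))

  sumS-∑ : ∀ {A : Set} (F : A → Series) xs n → sumS (map F xs) n ≡ ∑ xs (λ c → F c n)
  sumS-∑ F [] n = sym (∑-[] _)
  sumS-∑ F (x ∷ xs) n = trans (cong (_+_ (F x n)) (sumS-∑ F xs n)) (sym (∑-∷ x xs (λ c → F c n)))

  if-zeroS : ∀ b (F : Series) n → (if b then F else zeroS) n ≡ ind b (F n)
  if-zeroS true F n = refl
  if-zeroS false F n = refl

  chainSum≈chainsFromBottom : ∀ k → chainSum k N₀ ≈ chainsFromBottom 1 N₀ k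
  chainSum≈chainsFromBottom zero n = trans (sumS-∑ (λ c → if nonDecreasing c then prodS (map chainTerm c) else zeroS) (lists 0) n) (∑-singleton [] _)
  chainSum≈chainsFromBottom (suc k) n = trans (sumS-∑ (λ c → if nonDecreasing c then prodS (map chainTerm c) else zeroS) (lists (suc k)) n) (trans
      (∑-cong (lists (suc k)) (λ c → if-zeroS (nonDecreasing c) (chainProduct c) n))
     (trans (∑-lists-suc k _) (∑-parts-cong _ (λ x xge xle → trans (∑-lists-chain-∷ x k n) (trans (⊛-congʳ (chainTerm x) (listChains≈chainsFromBottom k x) n)
        (sym (trans (ind-∧ ⌊ 1 ℕ.≤? x ⌋ ⌊ x ℕ.≤? N₀ ⌋ ((chainTerm x ⊛ chainsFromBottom x N₀ k) n)) (trans (ind-yes (1 ℕ.≤? x) xge _) (ind-yes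
            (x ℕ.≤? N₀) xle _)))))))))

  chainSum≈chainSeries : ∀ k → chainSum k N₀ ≈ chainSeries N₀ k
  chainSum≈chainSeries k = ≈-trans (chainSum≈chainsFromBottom k) (chainsFromBottom≈chainsFromTop k 1 N₀)

  reduced≋chainSeries : ∀ b k → b ≤ N₀ → reduced b (binomWeight k) ≋ chainSeries b k
  reduced≋chainSeries zero zero _ = ≋i (≈-trans (reduced-empty (binomWeight 0)) constS-1)
  reduced≋chainSeries zero (suc k) _ = ≋i (≈-trans (reduced-empty (binomWeight (suc k))) (≈-trans (λ n → cong (λ z → constS z n) (binomWeight-at-0 k))
      (≈-trans constS-0 (≈-sym (chainSeries-0 k)))))
  reduced≋chainSeries (suc n) zero le = begin
      reduced (suc n) (binomWeight 0)
    ≈⟨ reduced-rec n (binomWeight 0) ⟩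
      reduced n (binomWeight 0) +ₛ chainTerm (suc n) *ₛ reduced (suc n) (Δ² (binomWeight 0))
    ≈⟨ +-cong (reduced≋chainSeries n 0 (ℕP.≤-trans (ℕP.n≤1+n n) le)) (*-cong ≋-refl (reduced-zeroWeight (suc n))) ⟩
      oneS +ₛ chainTerm (suc n) *ₛ zeroS
    ≈⟨ ≋-trans (+-cong ≋-refl (zeroʳ _)) (+-identityʳ _) ⟩
      oneS
    ∎
    where open ≋-Reasoning
  reduced≋chainSeries (suc n) (suc k) le = begin
      reduced (suc n) (binomWeight (suc k))
    ≈⟨ reduced-rec n (binomWeight (suc k)) ⟩
      reduced n (binomWeight (suc k)) +ₛ chainTerm (suc n) *ₛ reduced (suc n) (Δ² (binomWeight (suc k)))
    ≈⟨ +-cong (reduced≋chainSeries n (suc k) (ℕP.≤-trans (ℕP.n≤1+n n) le)) (*-cong ≋-refl (≋-trans (reduced-cong (suc n) (Δ²-binomWeight k))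
        (reduced≋chainSeries (suc n) k le))) ⟩
      chainSeries n (suc k) +ₛ chainTerm (suc n) *ₛ chainSeries (suc n) k
    ≈⟨ ≋i (λ m → trans (+ₛ-def _ _ m) (cong (_+_ (chainSeries n (suc k) m)) (*ₛ-def _ _ m))) ⟩
      (λ m → chainSeries n (suc k) m + (chainTerm (suc n) ⊛ chainSeries (suc n) k) m)
    ≈⟨ ≋i (≈-sym (chainSeries-suc n k le)) ⟩
      chainSeries (suc n) (suc k)
    ∎
    where open ≋-Reasoning

invPoch-suc : ∀ N → invPoch (suc N) ≈ (invPoch N ⊛ invOneMinus (suc N))
invPoch-suc N = ≈-trans (λ n → cong (λ l → prodS (map invOneMinus (map suc l)) n) (sym (LP.upTo-∷ʳ N)))
  (≈-trans (λ n → cong (λ l → prodS (map invOneMinus l) n) (LP.map-++ suc (upTo N) [ N ]))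
  (≈-trans (λ n → cong (λ l → prodS l n) (LP.map-++ invOneMinus (map suc (upTo N)) [ suc N ]))
  (≈-trans (prodS-++ (map invOneMinus (oneTo N)) [ invOneMinus (suc N) ]) (⊛-congʳ (invPoch N) (⊛-oneʳ (invOneMinus (suc N)))))))

invPoch-inverse : ∀ N → invPoch N *ₛ poch N ≋ oneS
invPoch-inverse zero = ≋-trans (≋i (λ n → trans (*ₛ-def oneS (poch 0) n) (⊛-congʳ oneS poch-zero n))) (≋i (⊛-oneˡ oneS))
invPoch-inverse (suc N) = begin
    invPoch (suc N) *ₛ poch (suc N)
  ≈⟨ *-cong hI (poch-factor N) ⟩
    (I *ₛ v) *ₛ (E -ₛ u *ₛ E)
  ≈⟨ solve 4 (λ I v E u → (I :* v) :* (E :- u :* E) := (I :* E) :* (v :* (con 1ℤ :- u))) (≋i (λ n → refl)) I v E u ⟩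
    (I *ₛ E) *ₛ (v *ₛ (𝟙 -ₛ u))
  ≈⟨ *-cong (invPoch-inverse N) (invOneMinus-inverse (suc N) (s≤s z≤n)) ⟩
    oneS *ₛ 𝟙
  ≈⟨ ≋-trans (*-identityˡ 𝟙) (≋i constS-1) ⟩
    oneS
  ∎
  where
  open ≋-Reasoning
  I = invPoch N
  v = invOneMinus (suc N)
  E = poch N
  u = monomial (suc N)
  hI : invPoch (suc N) ≋ I *ₛ v
  hI = ≋i (λ n → trans (invPoch-suc N n) (sym (*ₛ-def I v n)))

rhsSeries≈poch⊛crankSeries : ∀ N k → rhsSeries k N ≈ (poch N ⊛ crankSeries N N (binomWeight k))
rhsSeries≈poch⊛crankSeries N k = ≋at (begin
    rhsSeries k N
  ≈⟨ ≋i (⊛-congʳ (invPoch N) (Chains.chainSum≈chainSeries N k)) ⟩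
    invPoch N ⊛ Chains.chainSeries N N k
  ≈⟨ ≋i (λ n → sym (*ₛ-def (invPoch N) (Chains.chainSeries N N k) n)) ⟩
    invPoch N *ₛ Chains.chainSeries N N k
  ≈⟨ *-cong ≋-refl (≋-sym (Chains.reduced≋chainSeries N N k ℕP.≤-refl)) ⟩
    invPoch N *ₛ (poch N *ₛ (poch N *ₛ crankSeries N N (binomWeight k)))
  ≈⟨ ≋-sym (*-assoc (invPoch N) (poch N) _) ⟩
    (invPoch N *ₛ poch N) *ₛ (poch N *ₛ crankSeries N N (binomWeight k))
  ≈⟨ ≋-trans (*-cong (invPoch-inverse N) ≋-refl) (*-identityˡ _) ⟩
    poch N *ₛ crankSeries N N (binomWeight k)
  ≈⟨ ≋i (*ₛ-def (poch N) (crankSeries N N (binomWeight k))) ⟩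
    poch N ⊛ crankSeries N N (binomWeight k)
  ∎)
  where open ≋-Reasoning

crankSeries-at-0 : ∀ N k → crankSeries N N (binomWeight (suc k)) 0 ≡ 0ℤ
crankSeries-at-0 N k = trans (∑-singleton 0 _) (trans (∑-singleton 0 _) (trans (∑-singleton 0 _) (trans (cong (_*
    (partitions N 0 0 * partitions N 0 0)) (binomWeight-at-0 k)) refl)))

module Enumeration (N : ℕ) where
  open Lists N

  ∑-lists-headLe : ∀ L (B : List ℕ → Bool) z → ∑ (lists L) (λ w → ind (headLe N w ∧ B w) z) ≡ ∑ (lists L) (λ w → ind (B w) z)
  ∑-lists-headLe zero B z = trans (∑-singleton [] _) (sym (∑-singleton [] _))
  ∑-lists-headLe (suc L) B z = trans (∑-lists-suc L _) (trans (∑-parts-cong _ (λ x _ le → ∑-cong (lists L) (λ ys → trans (ind-∧ ⌊ x ℕ.≤? N ⌋ (B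
      (x ∷ ys)) z) (ind-yes (x ℕ.≤? N) le _)))) (sym (∑-lists-suc L _)))

  partitionsEnum : ℕ → ℕ → ℕ → ℤ
  partitionsEnum b L s = ∑ (lists L) (λ w → ind (headLe b w ∧ (nonIncreasing w ∧ ⌊ sumℕ w ℕ.≟ s ⌋)) 1ℤ)

  strictPartitionsEnum : ℕ → ℕ → ℕ → ℤ
  strictPartitionsEnum b L s = ∑ (lists L) (λ w → ind (headLe b w ∧ (decreasing w ∧ ⌊ sumℕ w ℕ.≟ s ⌋)) 1ℤ)

  boundedSum-partitions : ∀ L s → (∀ b → b ≤ N → partitionsEnum b L s ≡ partitions b L s) → ∀ b → b ≤ N → boundedSum b (λ x → ind ⌊ x ℕ.≤? s ⌋
      (partitions x L (s ∸ x))) ≡ partitions b (suc L) s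
  boundedSum-partitions L s IH zero le = boundedSum-0 _
  boundedSum-partitions L s IH (suc b) le = trans (boundedSum-suc b _ le) (cong (_+ ind ⌊ suc b ℕ.≤? s ⌋ (partitions (suc b) L (s ∸ suc b)))
      (boundedSum-partitions L s IH b (ℕP.≤-trans (ℕP.n≤1+n b) le)))

  boundedSum-strictPartitions : ∀ L s → ∀ b → b ≤ N → boundedSum b (λ x → ind ⌊ x ℕ.≤? s ⌋ (strictPartitions (pred x) L (s ∸ x))) ≡ strictPartitions b
      (suc L) s
  boundedSum-strictPartitions L s zero le = boundedSum-0 _
  boundedSum-strictPartitions L s (suc b) le = trans (boundedSum-suc b _ le) (cong (_+ ind ⌊ suc b ℕ.≤? s ⌋ (strictPartitions b L (s ∸ suc b)))
      (boundedSum-strictPartitions L s b (ℕP.≤-trans (ℕP.n≤1+n b) le)))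

  ind-∷-sum : ∀ A x σ s H Ni → ind (A ∧ ((H ∧ Ni) ∧ ⌊ x ℕ.+ σ ℕ.≟ s ⌋)) 1ℤ ≡ ind A (ind ⌊ x ℕ.≤? s ⌋ (ind (H ∧ (Ni ∧ ⌊ σ ℕ.≟ s ∸ x ⌋)) 1ℤ))
  ind-∷-sum A x σ s H Ni = trans (ind-∧ A _ 1ℤ) (cong (ind A) (trans (ind-∧ (H ∧ Ni) _ 1ℤ) (trans (ind-∧ H Ni _)
     (trans (cong (λ z → ind H (ind Ni z)) (ind-+-≟ x σ s)) (trans (cong (ind H) (ind-comm Ni ⌊ x ℕ.≤? s ⌋ _)) (trans (ind-comm H ⌊ x ℕ.≤? s ⌋ _)
     (cong (ind ⌊ x ℕ.≤? s ⌋) (trans (cong (ind H) (sym (ind-∧ Ni _ 1ℤ))) (sym (ind-∧ H _ 1ℤ))))))))))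

  partitionsEnum≡partitions : ∀ L b s → b ≤ N → partitionsEnum b L s ≡ partitions b L s
  partitionsEnum≡partitions zero b s le = trans (∑-singleton [] _) (ind-iff (0 ℕ.≟ s) (s ℕ.≟ 0) sym sym 1ℤ)
  partitionsEnum≡partitions (suc L) b s le = trans (∑-lists-suc L _) (trans (∑-cong parts (λ x → trans (∑-cong (lists L) (λ ys →
        trans (cong (λ c → ind (⌊ x ℕ.≤? b ⌋ ∧ (c ∧ ⌊ x ℕ.+ sumℕ ys ℕ.≟ s ⌋)) 1ℤ) (nonIncreasing-∷ x ys)) (ind-∷-sum ⌊ x ℕ.≤? b ⌋ x (sumℕ ys) s
            (headLe x ys) (nonIncreasing ys))))
        (trans (∑-ind (lists L) ⌊ x ℕ.≤? b ⌋ _) (cong (ind ⌊ x ℕ.≤? b ⌋) (∑-ind (lists L) ⌊ x ℕ.≤? s ⌋ _)))))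
     (trans (∑-parts-cong _ (λ x _ xle → cong (λ z → ind ⌊ x ℕ.≤? b ⌋ (ind ⌊ x ℕ.≤? s ⌋ z)) (partitionsEnum≡partitions L x (s ∸ x) xle)))
     (boundedSum-partitions L s (λ b' le' → partitionsEnum≡partitions L b' s le') b le)))

  strictPartitionsEnum≡strictPartitions : ∀ L b s → b ≤ N → strictPartitionsEnum b L s ≡ strictPartitions b L s
  strictPartitionsEnum≡strictPartitions zero b s le = trans (∑-singleton [] _) (ind-iff (0 ℕ.≟ s) (s ℕ.≟ 0) sym sym 1ℤ)
  strictPartitionsEnum≡strictPartitions (suc L) b s le = trans (∑-lists-suc L _) (trans (∑-cong parts (λ x → trans (∑-cong (lists L) (λ ys →
        trans (cong (λ c → ind (⌊ x ℕ.≤? b ⌋ ∧ (c ∧ ⌊ x ℕ.+ sumℕ ys ℕ.≟ s ⌋)) 1ℤ) (decreasing-∷ x ys)) (ind-∷-sum ⌊ x ℕ.≤? b ⌋ x (sumℕ ys) s (headLt x ys)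
            (decreasing ys))))
        (trans (∑-ind (lists L) ⌊ x ℕ.≤? b ⌋ _) (cong (ind ⌊ x ℕ.≤? b ⌋) (∑-ind (lists L) ⌊ x ℕ.≤? s ⌋ _)))))
     (trans (∑-parts-cong _ (λ x xge xle → cong (λ z → ind ⌊ x ℕ.≤? b ⌋ (ind ⌊ x ℕ.≤? s ⌋ z)) (inner x xge xle)))
     (boundedSum-strictPartitions L s b le)))
    where
    inner : ∀ x → 1 ≤ x → x ≤ N → ∑ (lists L) (λ ys → ind (headLt x ys ∧ (decreasing ys ∧ ⌊ sumℕ ys ℕ.≟ s ∸ x ⌋)) 1ℤ) ≡ strictPartitions (pred x) L
        (s ∸ x)
    inner (suc i) _ xle = trans (∑-cong (lists L) (λ ys → trans (ind-∧ (headLt (suc i) ys) _ 1ℤ) (trans (headLt-suc i ys _) (sym (ind-∧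
        (headLe i ys) _ 1ℤ)))))
                           (strictPartitionsEnum≡strictPartitions L i (s ∸ suc i) (ℕP.≤-trans (ℕP.n≤1+n i) xle))

  partitions-enum : ∀ L s → partitions N L s ≡ ∑ (lists L) (λ w → ind (nonIncreasing w ∧ ⌊ sumℕ w ℕ.≟ s ⌋) 1ℤ)
  partitions-enum L s = trans (sym (partitionsEnum≡partitions L N s ℕP.≤-refl)) (∑-lists-headLe L (λ w → nonIncreasing w ∧ ⌊ sumℕ w ℕ.≟ s ⌋) 1ℤ)

  strictPartitions-enum : ∀ L s → strictPartitions N L s ≡ ∑ (lists L) (λ w → ind (decreasing w ∧ ⌊ sumℕ w ℕ.≟ s ⌋) 1ℤ)
  strictPartitions-enum L s = trans (sym (strictPartitionsEnum≡strictPartitions L N s ℕP.≤-refl)) (∑-lists-headLe L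
      (λ w → decreasing w ∧ ⌊ sumℕ w ℕ.≟ s ⌋) 1ℤ)

module CrankMoments (N : ℕ) where
  open Lists N
  open Enumeration N

  partitionsᴺ : ℕ → Series
  partitionsᴺ L s = partitions N L s

  strictPartitionsᴺ : ℕ → Series
  strictPartitionsᴺ L s = strictPartitions N L s

  crankSum : (ℤ → ℤ) → ℕ → ℤ
  crankSum f n = ∑ (range n) λ L1 → ∑ (range n) λ L2 → ∑ (range n) λ L3 → signPow L1 * f (+ L2 - + L3) * ⊛₃ (strictPartitionsᴺ L1) (partitionsᴺ L2)
      (partitionsᴺ L3) n

  crankSeries-swap : ∀ f j → crankSeries N N f j ≡ ∑ (range j) (λ L2 → ∑ (range j) λ L3 → f (+ L2 - + L3) * (partitionsᴺ L2 ⊛ partitionsᴺ L3) j)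
  crankSeries-swap f j = trans (∑-swap (range j) (range j) (λ i L2 → ∑ (range j) λ L3 → f (+ L2 - + L3) * (partitions N L2 i * partitions N L3
      (j ∸ i))))
    (∑-cong (range j) λ L2 → trans (∑-swap (range j) (range j) (λ i L3 → f (+ L2 - + L3) * (partitions N L2 i * partitions N L3 (j ∸ i))))
      (∑-cong (range j) λ L3 → trans (∑-*ˡ (range j) (f (+ L2 - + L3)) (λ i → partitions N L2 i * partitions N L3 (j ∸ i))) (cong (f (+ L2 - + L3) *_)
          (sym (⊛-∑ (partitionsᴺ L2) (partitionsᴺ L3) j)))))

  -- Truncations to at most n parts; they agree with crankSeries N N and poch N up to q^n.
  crankSeriesᴺ : (ℤ → ℤ) → ℕ → Series
  crankSeriesᴺ f n j = ∑ (range n) λ L2 → ∑ (range n) λ L3 → f (+ L2 - + L3) * (partitionsᴺ L2 ⊛ partitionsᴺ L3) j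

  crankSeries≡crankSeriesᴺ : ∀ f n j → j ≤ n → crankSeries N N f j ≡ crankSeriesᴺ f n j
  crankSeries≡crankSeriesᴺ f n j le = trans (crankSeries-swap f j) (trans (∑-cong (range j) (λ L2 → sym (∑-upTo-extend (suc j) (suc n) (s≤s le)
      (λ L3 ge →
        trans (cong (f (+ L2 - + L3) *_) (⊛-vanishʳ (partitionsᴺ L2) (partitionsᴺ L3) j (λ i ile → partitions-vanish N L3 i (ℕP.<-≤-trans
            (s≤s ile) ge)))) (ℤP.*-zeroʳ (f (+ L2 - + L3)))))))
     (sym (∑-upTo-extend (suc j) (suc n) (s≤s le) (λ L2 ge → ∑-vanish (range n) (λ L3 →
        trans (cong (f (+ L2 - + L3) *_) (⊛-vanishˡ (partitionsᴺ L2) (partitionsᴺ L3) j (λ i ile → partitions-vanish N L2 i (ℕP.<-≤-trans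
            (s≤s ile) ge)))) (ℤP.*-zeroʳ (f (+ L2 - + L3))))))))

  pochᴺ : ℕ → Series
  pochᴺ n i = ∑ (range n) (λ L1 → signPow L1 * strictPartitionsᴺ L1 i)

  poch≡pochᴺ : ∀ n i → i ≤ n → poch N i ≡ pochᴺ n i
  poch≡pochᴺ n i le = sym (∑-upTo-extend (suc i) (suc n) (s≤s le) (λ L ge → trans (cong (signPow L *_) (strictPartitions-vanish N L i ge)) (ℤP.*-zeroʳ
      (signPow L))))

  poch⊛crankSeries≡crankSum : ∀ f n → (poch N ⊛ crankSeries N N f) n ≡ crankSum f n
  poch⊛crankSeries≡crankSum f n =
    begin
      (poch N ⊛ crankSeries N N f) n
    ≡⟨ ⊛-cong-≤ˡ (poch N) (pochᴺ n) (crankSeries N N f) n (poch≡pochᴺ n) ⟩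
      (pochᴺ n ⊛ crankSeries N N f) n
    ≡⟨ ⊛-cong-≤ʳ (pochᴺ n) (crankSeries N N f) (crankSeriesᴺ f n) n (crankSeries≡crankSeriesᴺ f n) ⟩
      (pochᴺ n ⊛ crankSeriesᴺ f n) n
    ≡⟨ ⊛-∑ˡ (range n) (λ L1 i → signPow L1 * strictPartitionsᴺ L1 i) (crankSeriesᴺ f n) n ⟩
      ∑ (range n) (λ L1 → ((λ i → signPow L1 * strictPartitionsᴺ L1 i) ⊛ crankSeriesᴺ f n) n)
    ≡⟨ ∑-cong (range n) (λ L1 → trans (⊛-*ˡ (signPow L1) (strictPartitionsᴺ L1) (crankSeriesᴺ f n) n) (cong (signPow L1 *_) (inner L1))) ⟩
      ∑ (range n) (λ L1 → signPow L1 * ∑ (range n) (λ L2 → ∑ (range n) λ L3 → f (+ L2 - + L3) * ⊛₃ (strictPartitionsᴺ L1) (partitionsᴺ L2)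
          (partitionsᴺ L3) n))
    ≡⟨ ∑-cong (range n) (λ L1 → trans (sym (∑-*ˡ (range n) (signPow L1) _)) (∑-cong (range n) λ L2 → trans (sym (∑-*ˡ (range n) (signPow L1) _))
          (∑-cong (range n) λ L3 → sym (ℤP.*-assoc (signPow L1) (f (+ L2 - + L3)) (⊛₃ (strictPartitionsᴺ L1) (partitionsᴺ L2)
              (partitionsᴺ L3) n))))) ⟩
      crankSum f n
    ∎
    where
    open ≡-Reasoning
    inner : ∀ L1 → (strictPartitionsᴺ L1 ⊛ crankSeriesᴺ f n) n ≡ ∑ (range n) (λ L2 → ∑ (range n) λ L3 → f (+ L2 - + L3) * ⊛₃ (strictPartitionsᴺ L1)
        (partitionsᴺ L2) (partitionsᴺ L3) n)
    inner L1 = trans (⊛-∑ʳ (range n) (strictPartitionsᴺ L1) (λ L2 j → ∑ (range n) λ L3 → f (+ L2 - + L3) * (partitionsᴺ L2 ⊛ partitionsᴺ L3) j) n)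
      (∑-cong (range n) λ L2 → trans (⊛-∑ʳ (range n) (strictPartitionsᴺ L1) (λ L3 j → f (+ L2 - + L3) * (partitionsᴺ L2 ⊛ partitionsᴺ L3) j) n)
        (∑-cong (range n) λ L3 → trans (⊛-*ʳ (f (+ L2 - + L3)) (strictPartitionsᴺ L1) (partitionsᴺ L2 ⊛ partitionsᴺ L3) n)
           (cong (f (+ L2 - + L3) *_) (trans (sym (⊛-assoc (strictPartitionsᴺ L1) (partitionsᴺ L2) (partitionsᴺ L3) n)) (⊛⊛≡⊛₃ (strictPartitionsᴺ L1)
               (partitionsᴺ L2) (partitionsᴺ L3) n)))))

  inS₂ : List ℕ → List ℕ → List ℕ → ℕ → Bool
  inS₂ p1 p2 p3 n = decreasing p1 ∧ (nonIncreasing p2 ∧ (nonIncreasing p3 ∧ ⌊ sumℕ p1 ℕ.+ sumℕ p2 ℕ.+ sumℕ p3 ℕ.≟ n ⌋))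

  ⊛₃-enumerate : ∀ L1 L2 L3 n → ⊛₃ (strictPartitionsᴺ L1) (partitionsᴺ L2) (partitionsᴺ L3) n ≡ ∑ (lists L1) (λ p1 → ∑ (lists L2) λ p2 → ∑
      (lists L3) λ p3 → ind (inS₂ p1 p2 p3 n) 1ℤ)
  ⊛₃-enumerate L1 L2 L3 n =
    trans (⊛₃-cong {g = partitionsᴺ L2} {h = partitionsᴺ L3} (λ a → strictPartitions-enum L1 a) (λ b → partitions-enum L2 b)
        (λ c → partitions-enum L3 c) n)
    (trans (⊛₃-∑₁ (lists L1) φ (λ b → ∑ (lists L2) λ p2 → γ p2 b) (λ c → ∑ (lists L3) λ p3 → η p3 c) n)
    (∑-cong (lists L1) λ p1 → trans (⊛₃-∑₂ (lists L2) (φ p1) γ (λ c → ∑ (lists L3) λ p3 → η p3 c) n)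
    (∑-cong (lists L2) λ p2 → trans (⊛₃-∑₃ (lists L3) (φ p1) (γ p2) η n)
    (∑-cong (lists L3) λ p3 → ⊛₃-indicators (decreasing p1) (nonIncreasing p2) (nonIncreasing p3) (sumℕ p1) (sumℕ p2) (sumℕ p3) n))))
    where
    φ : List ℕ → Series
    φ p1 a = ind (decreasing p1 ∧ ⌊ sumℕ p1 ℕ.≟ a ⌋) 1ℤ
    γ : List ℕ → Series
    γ p2 b = ind (nonIncreasing p2 ∧ ⌊ sumℕ p2 ℕ.≟ b ⌋) 1ℤ
    η : List ℕ → Series
    η p3 c = ind (nonIncreasing p3 ∧ ⌊ sumℕ p3 ℕ.≟ c ⌋) 1ℤ

  crankRange : ℕ → List ℤ
  crankRange n = map (λ i → + i - + n) (upTo (suc (2 ℕ.* n)))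

  shiftedCrank : ∀ a b n → b ≤ n → + (a ℕ.+ n ∸ b) - + n ≡ + a - + b
  shiftedCrank a b n le = trans (alg (+ (a ℕ.+ n ∸ b)) (+ b) (+ n)) (trans (cong (λ z → z - (+ n + + b)) (trans (sym (ℤP.pos-+ (a ℕ.+ n ∸ b) b))
      (cong +_ (ℕP.m∸n+n≡m (ℕP.≤-trans le (ℕP.m≤n+m n a)))))) (trans (cong (λ z → z - (+ n + + b)) (ℤP.pos-+ a n)) (alg2 (+ a) (+ b) (+ n))))
    where
    alg : ∀ k b n → k - n ≡ (k + b) - (n + b)
    alg = solve-∀
    alg2 : ∀ a b n → (a + n) - (n + b) ≡ a - b
    alg2 = solve-∀

  shiftedCrank-inverse : ∀ a b n i → b ≤ n → + a - + b ≡ + i - + n → i ≡ a ℕ.+ n ∸ b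
  shiftedCrank-inverse a b n i le e = trans (sym (ℕP.m+n∸n≡m i b)) (cong (_∸ b) (sym (ℤP.+-injective (trans (ℤP.pos-+ a n) (trans (alg (+ a) (+ b)
      (+ n)) (trans (cong (λ z → z + (+ b + + n)) e) (trans (alg2 (+ i) (+ b) (+ n)) (sym (ℤP.pos-+ i b)))))))))
    where
    alg : ∀ a b n → a + n ≡ (a - b) + (b + n)
    alg = solve-∀
    alg2 : ∀ i b n → (i - n) + (b + n) ≡ i + b
    alg2 = solve-∀

  crankRange-select : ∀ (f : ℤ → ℤ) n a b (Ab : Bool) w → a ≤ n → b ≤ n → ∑ (crankRange n) (λ m → f m * ind (Ab ∧ ⌊ + a - + b ℤ.≟ m ⌋) w) ≡ ind Ab (f
      (+ a - + b) * w)
  crankRange-select f n a b Ab w ale ble =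
    trans (∑-map (λ i → + i - + n) (upTo (suc (2 ℕ.* n))) _)
    (trans (∑-cong (upTo (suc (2 ℕ.* n))) (λ i → trans (cong (f (+ i - + n) *_) (ind-∧ Ab _ w)) (trans (ind-*ˡ Ab _ (f (+ i - + n))) (cong (ind Ab)
        (ind-*ˡ ⌊ + a - + b ℤ.≟ + i - + n ⌋ w (f (+ i - + n)))))))
    (trans (∑-ind (upTo (suc (2 ℕ.* n))) Ab _) (cong (ind Ab)
      (trans (∑-cong (upTo (suc (2 ℕ.* n))) (λ i → ind-iff (+ a - + b ℤ.≟ + i - + n) (i ℕ.≟ a ℕ.+ n ∸ b) (shiftedCrank-inverse a b n i ble)
          (λ e → trans (sym (shiftedCrank a b n ble)) (cong (λ z → + z - + n) (sym e))) _))
      (trans (∑-upTo-select-< (suc (2 ℕ.* n)) (a ℕ.+ n ∸ b) (λ i → f (+ i - + n) * w) rng) (cong (λ z → f z * w) (shiftedCrank a b n ble)))))))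
    where
    rng : a ℕ.+ n ∸ b < suc (2 ℕ.* n)
    rng = s≤s (ℕP.≤-trans (ℕP.m∸n≤m (a ℕ.+ n) b) (ℕP.≤-trans (ℕP.+-monoˡ-≤ n ale) (ℕP.≤-reflexive (cong (n ℕ.+_) (sym (ℕP.+-identityʳ n))))))

  ∑-listsUpTo : ∀ n (G : List ℕ → ℤ) → ∑ (listsUpTo N n) G ≡ ∑ (range n) (λ L → ∑ (lists L) G)
  ∑-listsUpTo n G = ∑-concatMap (listsOfLength N) (range n) G

  ∑-candidates : ∀ n (F : Triple → ℤ) → ∑ (candidates N n) F ≡
     ∑ (range n) (λ L1 → ∑ (lists L1) λ p1 → ∑ (range n) λ L2 → ∑ (lists L2) λ p2 → ∑ (range n) λ L3 → ∑ (lists L3) λ p3 → F (p1 , p2 , p3))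
  ∑-candidates n F =
    trans (∑-concatMap _ (listsUpTo N n) F)
    (trans (∑-cong (listsUpTo N n) (λ p1 → trans (∑-concatMap _ (listsUpTo N n) F) (∑-cong (listsUpTo N n) (λ p2 → trans (∑-map _ (listsUpTo N n) F)
        (∑-listsUpTo n _)))))
    (trans (∑-cong (listsUpTo N n) (λ p1 → ∑-listsUpTo n _)) (trans (∑-listsUpTo n _) (∑-cong (range n) λ L1 → ∑-cong (lists L1) λ p1 → ∑-cong
        (range n) λ L2 → ∑-cong (lists L2) λ p2 → refl))))

  crankListSum : (ℤ → ℤ) → ℕ → ℤ
  crankListSum f n = ∑ (range n) λ L1 → ∑ (lists L1) λ p1 → ∑ (range n) λ L2 → ∑ (lists L2) λ p2 → ∑ (range n) λ L3 → ∑ (lists L3) λ p3 → ind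
      (inS₂ p1 p2 p3 n) (f (+ L2 - + L3) * signPow L1)

  crankSum≡crankListSum : ∀ f n → crankSum f n ≡ crankListSum f n
  crankSum≡crankListSum f n =
    begin
      crankSum f n
    ≡⟨ ∑-cong (range n) (λ L1 → ∑-cong (range n) λ L2 → ∑-cong (range n) λ L3 → let c = signPow L1 * f (+ L2 - + L3) in trans (cong (c *_)
        (⊛₃-enumerate L1 L2 L3 n))
          (trans (sym (∑-*ˡ (lists L1) c (λ p1 → ∑ (lists L2) λ p2 → ∑ (lists L3) λ p3 → ind (inS₂ p1 p2 p3 n) 1ℤ))) (∑-cong (lists L1) λ p1 → trans
              (sym (∑-*ˡ (lists L2) c (λ p2 → ∑ (lists L3) λ p3 → ind (inS₂ p1 p2 p3 n) 1ℤ))) (∑-cong (lists L2) λ p2 → trans (sym (∑-*ˡ (lists L3) c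
              (λ p3 → ind (inS₂ p1 p2 p3 n) 1ℤ)))
             (∑-cong (lists L3) λ p3 → trans (ind-*ˡ (inS₂ p1 p2 p3 n) 1ℤ (signPow L1 * f (+ L2 - + L3))) (cong (ind (inS₂ p1 p2 p3 n))
                (trans (ℤP.*-identityʳ _) (ℤP.*-comm (signPow L1) (f (+ L2 - + L3)))))))))) ⟩
      ∑ (range n) (λ L1 → ∑ (range n) λ L2 → ∑ (range n) λ L3 → ∑ (lists L1) λ p1 → ∑ (lists L2) λ p2 → ∑ (lists L3) λ p3 → ind (inS₂ p1 p2 p3 n) (f
          (+ L2 - + L3) * signPow L1))
    ≡⟨ ∑-cong (range n) (λ L1 → trans (∑-cong (range n) λ L2 → ∑-swap (range n) (lists L1) _) (∑-swap (range n) (lists L1) _)) ⟩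
      ∑ (range n) (λ L1 → ∑ (lists L1) λ p1 → ∑ (range n) λ L2 → ∑ (range n) λ L3 → ∑ (lists L2) λ p2 → ∑ (lists L3) λ p3 → ind (inS₂ p1 p2 p3 n) (f
          (+ L2 - + L3) * signPow L1))
    ≡⟨ ∑-cong (range n) (λ L1 → ∑-cong (lists L1) λ p1 → ∑-cong (range n) λ L2 → ∑-swap (range n) (lists L2) _) ⟩
      crankListSum f n
    ∎
    where open ≡-Reasoning

  μSum≡crankListSum : ∀ (f : ℤ → ℤ) n → sumℤ (map (λ m → f m * M-S₂ N m n) (crankRange n)) ≡ crankListSum f n
  μSum≡crankListSum f n =
    begin
      sumℤ (map (λ m → f m * M-S₂ N m n) (crankRange n))
    ≡⟨ sym (∑-def (crankRange n) _) ⟩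
      ∑ (crankRange n) (λ m → f m * M-S₂ N m n)
    ≡⟨ ∑-cong (crankRange n) (λ m → trans (cong (f m *_) (sym (∑-def (candidates N n) _))) (sym (∑-*ˡ (candidates N n) (f m) _))) ⟩
      ∑ (crankRange n) (λ m → ∑ (candidates N n) λ t → f m * ind (inS₂of n t ∧ ⌊ crank t ℤ.≟ m ⌋) (weight t))
    ≡⟨ ∑-swap (crankRange n) (candidates N n) _ ⟩
      ∑ (candidates N n) (λ t → ∑ (crankRange n) λ m → f m * ind (inS₂of n t ∧ ⌊ crank t ℤ.≟ m ⌋) (weight t))
    ≡⟨ ∑-candidates n _ ⟩
      ∑ (range n) (λ L1 → ∑ (lists L1) λ p1 → ∑ (range n) λ L2 → ∑ (lists L2) λ p2 → ∑ (range n) λ L3 → ∑ (lists L3) λ p3 →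
         ∑ (crankRange n) λ m → f m * ind (inS₂ p1 p2 p3 n ∧ ⌊ + length p2 - + length p3 ℤ.≟ m ⌋) (signPow (length p1)))
    ≡⟨ ∑-upTo-cong (suc n) (λ L1 l1 → ∑-lists-length-cong L1 λ p1 e1 → ∑-upTo-cong (suc n) λ L2 l2 → ∑-lists-length-cong L2 λ p2 e2 → ∑-upTo-cong
        (suc n) λ L3 l3 → ∑-lists-length-cong L3 λ p3 e3 →
         trans (cong₂ (λ u v → ∑ (crankRange n) λ m → f m * ind (inS₂ p1 p2 p3 n ∧ ⌊ + u - + v ℤ.≟ m ⌋) (signPow (length p1))) e2 e3)
         (trans (cong (λ u → ∑ (crankRange n) λ m → f m * ind (inS₂ p1 p2 p3 n ∧ ⌊ + L2 - + L3 ℤ.≟ m ⌋) (signPow u)) e1)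
           (crankRange-select f n L2 L3 (inS₂ p1 p2 p3 n) (signPow L1) (ℕP.≤-pred l2) (ℕP.≤-pred l3)))) ⟩
      crankListSum f n
    ∎
    where open ≡-Reasoning

  μ≡poch⊛crankSeries : ∀ k n → μ k N n ≡ (poch N ⊛ crankSeries N N (binomWeight k)) n
  μ≡poch⊛crankSeries k n = begin
    μ k N n                                          ≡⟨ μSum≡crankListSum (binomWeight k) n ⟩
    crankListSum (binomWeight k) n                   ≡⟨ crankSum≡crankListSum (binomWeight k) n ⟨
    crankSum (binomWeight k) n                       ≡⟨ poch⊛crankSeries≡crankSum (binomWeight k) n ⟨
    (poch N ⊛ crankSeries N N (binomWeight k)) n     ∎
    where open ≡-Reasoning

rhsSeries-at-0 : ∀ N k → rhsSeries (suc k) N 0 ≡ 0ℤ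
rhsSeries-at-0 N k = begin
  rhsSeries (suc k) N 0                                      ≡⟨ rhsSeries≈poch⊛crankSeries N (suc k) 0 ⟩
  (poch N ⊛ crankSeries N N (binomWeight (suc k))) 0        ≡⟨ ⊛-∑ (poch N) (crankSeries N N (binomWeight (suc k))) 0 ⟩
  ∑ [ 0 ] (λ i → poch N i * crankSeries N N (binomWeight (suc k)) (0 ∸ i))
                                                             ≡⟨ ∑-singleton 0 _ ⟩
  poch N 0 * crankSeries N N (binomWeight (suc k)) 0         ≡⟨ cong (poch N 0 *_) (crankSeries-at-0 N k) ⟩
  poch N 0 * 0ℤ                                              ≡⟨ ℤP.*-zeroʳ (poch N 0) ⟩
  0ℤ                                                         ∎
  where open ≡-Reasoning

corollary5p3 : (N k : ℕ) → 1 ≤ N → 1 ≤ k →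
    (n : ℕ) → lhsSeries k N n ≡ rhsSeries k N n
corollary5p3 N (suc k) _ _ zero = sym (rhsSeries-at-0 N k)
corollary5p3 N (suc k) _ _ (suc n) =
  trans (CrankMoments.μ≡poch⊛crankSeries N (suc k) (suc n)) (sym (rhsSeries≈poch⊛crankSeries N (suc k) (suc n)))
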